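{- None of the following matroids belongs to $\mathcal{S}$: (i) $U_{0,1}\oplus U_{1,1}\oplus U_{1,3}$; (ii) $U_{0,1}\oplus U_{1,1}\oplus U_{2,3}$; (iii) $U_{0,1}\oplus U_{2,4}$; (iv) $U_{1,1}\oplus U_{2,4}$; (v) $U_{1,2}\oplus M(H)$, where $H$ is the graph obtained from a cycle on three vertices by adding one edge parallel to one of its edges.
   Context: Graphs may have loops and parallel edges. A theta-subgraph consists of two distinct vertices $u,v$ and three internally vertex-disjoint $u$–$v$ paths. A linear class is a collection $\mathcal{B}$ of cycles of a graph such that no theta-subgraph contains exactly two cycles of $\mathcal{B}$; cycles in $\mathcal{B}$ are balanced, others unbalanced. The lift matroid $L(G,\mathcal{B})$ on $E(G)$ has as circuits the edge-sets of balanced cycles, of theta-subgraphs containing an unbalanced cycle, and of unions of two unbalanced cycles sharing at most one vertex. For $r\geq 3$, $\Delta_{r}$ is obtained from a cycle with $r$ edges by replacing each edge by a parallel pair; a spike is $L(\Delta_{r},\mathcal{B})$ with $\mathcal{B}$ a linear class of Hamiltonian cycles of $\Delta_{r}$. $\mathcal{S}$ is the class of matroids isomorphic to minors of spikes. $M(H)$ denotes the cycle matroid of $H$. -}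

module Defs where

open import Data.Nat using (ℕ; zero; suc; _+_; _≥_)
open import Data.Fin using (Fin; zero; suc)
open import Data.Fin.Subset using (Subset; _∈_; _⊆_; _∪_; _∩_; _─_; ⊥; ⊤; ⁅_⁆; ⋃; ∣_∣; Nonempty)
open import Data.Vec using (_++_; lookup)
open import Data.List using (List; []; _∷_; map; length; drop; allFin)
open import Data.List.Relation.Unary.Unique.Propositional using (Unique)
import Data.List.Membership.Propositional as LM
open import Data.Product using (Σ; ∃; ∃-syntax; _×_; _,_; proj₁; proj₂)
open import Data.Sum using (_⊎_)
open import Data.Bool using (if_then_else_)
open import Data.Empty renaming (⊥ to Empty)
open import Relation.Nullary using (¬_)
open import Relation.Binary.PropositionalEquality using (_≡_; _≢_)
open import Function.Definitions using (Injective)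

-- Graphs (loops and parallel edges allowed): vertex set Fin V, edge set
-- Fin m, each edge has an (unordered) pair of ends.

record Graph (V m : ℕ) : Set where
  field ends : Fin m → Fin V × Fin V
open Graph public

Joins : ∀ {V m} → Graph V m → Fin m → Fin V → Fin V → Set
Joins G e x z = (ends G e ≡ (x , z)) ⊎ (ends G e ≡ (z , x))

data Walk {V m} (G : Graph V m) : Fin V → Fin V → Set where
  []   : ∀ {x} → Walk G x x
  step : ∀ {x y z} (e : Fin m) → Joins G e x z → Walk G z y → Walk G x y

module _ {V m} {G : Graph V m} where
  edges : ∀ {x y} → Walk G x y → List (Fin m)
  edges [] = []
  edges (step e _ w) = e ∷ edges w

  verts : ∀ {x y} → Walk G x y → List (Fin V)
  verts {x} [] = x ∷ []
  verts {x} (step e _ w) = x ∷ verts w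

  edgeSet : ∀ {x y} → Walk G x y → Subset m
  edgeSet w = ⋃ (map ⁅_⁆ (edges w))

dropLast : ∀ {A : Set} → List A → List A
dropLast [] = []
dropLast (x ∷ []) = []
dropLast (x ∷ y ∷ r) = x ∷ dropLast (y ∷ r)

internal : ∀ {V m} {G : Graph V m} {x y} → Walk G x y → List (Fin V)
internal [] = []
internal (step e _ w) = dropLast (verts w)

IsPath : ∀ {V m} {G : Graph V m} {x y} → Walk G x y → Set
IsPath w = Unique (verts w)

IsCycleWalk : ∀ {V m} {G : Graph V m} {x} → Walk G x x → Set
IsCycleWalk w = (length (edges w) ≥ 1) × Unique (edges w) × Unique (drop 1 (verts w))

IsCycle : ∀ {V m} → Graph V m → Subset m → Set
IsCycle G C = ∃[ x ] Σ (Walk G x x) (λ w → IsCycleWalk w × edgeSet w ≡ C)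

VertexOf : ∀ {V m} → Graph V m → Fin V → Subset m → Set
VertexOf G v S = ∃[ e ] (e ∈ S × (proj₁ (ends G e) ≡ v ⊎ proj₂ (ends G e) ≡ v))

IsHamiltonianCycle : ∀ {V m} → Graph V m → Subset m → Set
IsHamiltonianCycle G C = IsCycle G C × (∀ v → VertexOf G v C)

InternallyDisjoint : ∀ {V m} {G : Graph V m} {u v} → Walk G u v → Walk G u v → Set
InternallyDisjoint P Q = ∀ z → z LM.∈ internal P → z LM.∈ internal Q → Empty

IsTheta : ∀ {V m} → Graph V m → Subset m → Set
IsTheta G T =
  ∃[ u ] ∃[ v ] (u ≢ v × Σ (Walk G u v) λ P₁ → Σ (Walk G u v) λ P₂ → Σ (Walk G u v) λ P₃ →
    IsPath P₁ × IsPath P₂ × IsPath P₃ ×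
    InternallyDisjoint P₁ P₂ × InternallyDisjoint P₁ P₃ × InternallyDisjoint P₂ P₃ ×
    edgeSet P₁ ≢ edgeSet P₂ × edgeSet P₁ ≢ edgeSet P₃ × edgeSet P₂ ≢ edgeSet P₃ ×
    T ≡ edgeSet P₁ ∪ edgeSet P₂ ∪ edgeSet P₃)

ContainsExactlyTwo : ∀ {m} → (Subset m → Set) → Subset m → Set
ContainsExactlyTwo B T =
  ∃[ C₁ ] ∃[ C₂ ] (C₁ ≢ C₂ × B C₁ × B C₂ × C₁ ⊆ T × C₂ ⊆ T ×
    (∀ C → B C → C ⊆ T → (C ≡ C₁) ⊎ (C ≡ C₂)))

IsLinearClass : ∀ {V m} → Graph V m → (Subset m → Set) → Set
IsLinearClass G B = (∀ C → B C → IsCycle G C) ×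
  (∀ T → IsTheta G T → ¬ ContainsExactlyTwo B T)

record Matroid (n : ℕ) : Set₁ where
  field Circuit : Subset n → Set
open Matroid public

Lift : ∀ {V m} → Graph V m → (Subset m → Set) → Matroid m
Circuit (Lift G B) X =
  B X
  ⊎ (IsTheta G X × ∃[ C ] (IsCycle G C × ¬ B C × C ⊆ X))
  ⊎ ∃[ C₁ ] ∃[ C₂ ] (IsCycle G C₁ × IsCycle G C₂ × ¬ B C₁ × ¬ B C₂ × C₁ ≢ C₂ ×
       (∀ a b → VertexOf G a C₁ → VertexOf G a C₂ → VertexOf G b C₁ → VertexOf G b C₂ → a ≡ b) ×
       X ≡ C₁ ∪ C₂)

CycleMatroid : ∀ {V m} → Graph V m → Matroid m
Circuit (CycleMatroid H) X = IsCycle H X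

U : ℕ → (n : ℕ) → Matroid n
Circuit (U r n) X = ∣ X ∣ ≡ suc r

_⊕_ : ∀ {a b} → Matroid a → Matroid b → Matroid (a + b)
Circuit (_⊕_ {a} {b} M N) X = (∃[ C ] (Circuit M C × X ≡ C ++ ⊥)) ⊎ (∃[ D ] (Circuit N D × X ≡ ⊥ ++ D))
infixr 5 _⊕_

-- Δ_r, r = k + 3: vertices Fin r in cyclic order; edges Fin (r + r),
-- edges i and r + i both join i and i+1 (mod r).

cyc : ∀ {n} → Fin (suc n) → Fin (suc n)
cyc {zero} zero = zero
cyc {suc n} zero = suc zero
cyc {suc n} (suc i) = shift (cyc {n} i)
  where
  shift : Fin (suc n) → Fin (suc (suc n))
  shift zero = zero
  shift (suc j) = suc (suc j)

pairEnds : ∀ {n} → Fin (n + n) → Fin n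
pairEnds {n} e = Data.Sum.[ (λ i → i) , (λ i → i) ] (Data.Fin.splitAt n e)

Δ : (k : ℕ) → Graph (3 + k) ((3 + k) + (3 + k))
ends (Δ k) e = pairEnds e , cyc (pairEnds e)

IsSpikeClass : (k : ℕ) → (Subset ((3 + k) + (3 + k)) → Set) → Set
IsSpikeClass k B = IsLinearClass (Δ k) B × (∀ C → B C → IsHamiltonianCycle (Δ k) C)

image : ∀ {k n} → (Fin k → Fin n) → Subset k → Subset n
image {k} f Z = ⋃ (map (λ i → if lookup Z i then ⁅ f i ⁆ else ⊥) (allFin k))

ContractCircuit : ∀ {n} → Matroid n → Subset n → Subset n → Set
ContractCircuit M X Y = Nonempty Y × (∃[ C ] (Circuit M C × C ─ X ≡ Y)) ×
  (∀ C′ → Circuit M C′ → Nonempty (C′ ─ X) → C′ ─ X ⊆ Y → C′ ─ X ≡ Y)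

-- N is isomorphic to the minor M / X \ (E ─ X ─ image f) of M, via the bijection f
-- from E(N) onto the ground set image f ⊤ of the minor
IsoToMinor : ∀ {k n} → Matroid k → Matroid n → Set
IsoToMinor {k} {n} N M = ∃[ f ] ∃[ X ] (Injective _≡_ _≡_ f × X ∩ image f ⊤ ≡ ⊥ ×
  (∀ Z → (Circuit N Z → ContractCircuit M X (image f Z)) × (ContractCircuit M X (image f Z) → Circuit N Z)))

InS : ∀ {n} → Matroid n → Set₁
InS N = ∃[ k ] ∃[ B ] (IsSpikeClass k B × IsoToMinor N (Lift (Δ k) B))

H : Graph 3 4
ends H zero = zero , suc zero
ends H (suc zero) = suc zero , suc (suc zero)
ends H (suc (suc zero)) = suc (suc zero) , zero
ends H (suc (suc (suc zero))) = zero , suc zero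

module Submission where

-- The 2r edges of Δ_r pair up into r legs {e, ē} of parallel edges. Counting, leg by leg, the parity of the
-- edges a walk uses shows that every circuit of a spike is either a union of at least two whole legs or meets
-- every leg, while any two legs, and any theta formed by one leg and a transversal of the others, are circuits.
-- In a minor N = M / X \ Y this leaves little freedom for the partner ē of an element e of N. If X contains a
-- whole leg, the partner of a non-loop e is not contracted, and e is parallel to ē whenever ē lies in N.
-- Otherwise a loop of N forces a contracted edge on every other leg, and two elements whose partners are
-- contracted are parallel. For each of the five matroids, these rules applied to a few of its circuits and
-- non-circuits lead to a contradiction.

open import Defs
open import Data.Nat using (ℕ)
open import Data.Product using (_×_; _,_)
open import Relation.Nullary using (¬_)

module SubsetFacts where
  open import Data.Bool using (true; false; if_then_else_)
  open import Data.Fin using (Fin; zero; suc)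
  open import Data.Fin.Subset
  open import Data.Fin.Subset.Properties
  open import Data.List using (List; []; _∷_; map; allFin)
  import Data.List.Membership.Propositional as List
  open import Data.List.Membership.Propositional.Properties using (∈-allFin)
  open import Data.List.Relation.Unary.Any using (here; there)
  open import Data.Product using (∃; _×_; _,_)
  open import Data.Sum using (inj₁; inj₂)
  open import Data.Vec using (_∷_; lookup)
  import Data.Vec as Vec
  open import Data.Vec.Properties using (lookup⇒[]=; []=⇒lookup)
  open import Relation.Nullary using (contradiction)
  open import Relation.Binary.PropositionalEquality

  x∈p─q⇒x∈p×x∉q : ∀ {n} {p q : Subset n} {x} → x ∈ p ─ q → x ∈ p × x ∉ q
  x∈p─q⇒x∈p×x∉q {p = inside ∷ p} {outside ∷ q} {zero} Vec.here = Vec.here , λ ()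
  x∈p─q⇒x∈p×x∉q {p = _ ∷ p} {inside ∷ q} {zero} ()
  x∈p─q⇒x∈p×x∉q {p = outside ∷ p} {outside ∷ q} {zero} ()
  x∈p─q⇒x∈p×x∉q {p = _ ∷ p} {_ ∷ q} {suc x} (Vec.there x∈) with x∈p─q⇒x∈p×x∉q {p = p} {q} x∈
  ... | x∈p , x∉q = Vec.there x∈p , λ { (Vec.there x∈q) → x∉q x∈q }

  ∈-⋃⁅⁆⁻ : ∀ {n} (l : List (Fin n)) {x} → x ∈ ⋃ (map ⁅_⁆ l) → x List.∈ l
  ∈-⋃⁅⁆⁻ []      x∈ = contradiction x∈ ∉⊥
  ∈-⋃⁅⁆⁻ (y ∷ l) x∈ with x∈p∪q⁻ ⁅ y ⁆ _ x∈
  ... | inj₁ x∈y = here (x∈⁅y⁆⇒x≡y y x∈y)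
  ... | inj₂ x∈l = there (∈-⋃⁅⁆⁻ l x∈l)

  ∈-⋃⁅⁆⁺ : ∀ {n} (l : List (Fin n)) {x} → x List.∈ l → x ∈ ⋃ (map ⁅_⁆ l)
  ∈-⋃⁅⁆⁺ (y ∷ l) (here refl) = x∈p∪q⁺ (inj₁ (x∈⁅x⁆ y))
  ∈-⋃⁅⁆⁺ (y ∷ l) (there x∈) = x∈p∪q⁺ (inj₂ (∈-⋃⁅⁆⁺ l x∈))

  module _ {k n} (f : Fin k → Fin n) (Z : Subset k) where

    private
      Member : Fin k → Subset n
      Member i = if lookup Z i then ⁅ f i ⁆ else ⊥

    ∈-image⁻ : ∀ {y} → y ∈ image f Z → ∃ λ i → i ∈ Z × f i ≡ y
    ∈-image⁻ {y} = go (allFin k)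
      where
      go : (l : List (Fin k)) → y ∈ ⋃ (map Member l) → ∃ λ i → i ∈ Z × f i ≡ y
      go []      y∈ = contradiction y∈ ∉⊥
      go (i ∷ l) y∈ with lookup Z i in i∈Z
      ... | true with x∈p∪q⁻ ⁅ f i ⁆ _ y∈
      ...   | inj₁ y≡ = i , lookup⇒[]= i Z i∈Z , sym (x∈⁅y⁆⇒x≡y (f i) y≡)
      ...   | inj₂ y∈l = go l y∈l
      go (i ∷ l) y∈ | false with x∈p∪q⁻ ⊥ _ y∈
      ...   | inj₁ y∈⊥ = contradiction y∈⊥ ∉⊥
      ...   | inj₂ y∈l = go l y∈l

    ∈-image⁺ : ∀ {i} → i ∈ Z → f i ∈ image f Z
    ∈-image⁺ {i} i∈Z = go (allFin k) (∈-allFin i)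
      where
      go : (l : List (Fin k)) → i List.∈ l → f i ∈ ⋃ (map Member l)
      go (j ∷ l) (there i∈l) = x∈p∪q⁺ (inj₂ (go l i∈l))
      go (j ∷ l) (here refl) rewrite []=⇒lookup i∈Z = x∈p∪q⁺ (inj₁ (x∈⁅x⁆ (f j)))

  -- Sealed: letting Agda unfold image f Z for concrete Z makes typechecking several times slower.
  opaque
    Im : ∀ {k n} → (Fin k → Fin n) → Subset k → Subset n
    Im = image

    Im≡image : ∀ {k n} (f : Fin k → Fin n) Z → Im f Z ≡ image f Z
    Im≡image f Z = refl

  ∈-Im⁻ : ∀ {k n} (f : Fin k → Fin n) (Z : Subset k) {y} → y ∈ Im f Z → ∃ λ i → i ∈ Z × f i ≡ y
  ∈-Im⁻ f Z y∈ = ∈-image⁻ f Z (subst (_ ∈_) (Im≡image f Z) y∈)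

  ∈-Im⁺ : ∀ {k n} (f : Fin k → Fin n) (Z : Subset k) {i} → i ∈ Z → f i ∈ Im f Z
  ∈-Im⁺ f Z i∈Z = subst (_ ∈_) (sym (Im≡image f Z)) (∈-image⁺ f Z i∈Z)

module CyclicOrder where
  open import Data.Nat using (ℕ; zero; suc; _+_; _∸_; _<_; _≤_; z≤n; s≤s; _%_; NonZero; _<?_)
  open import Data.Nat.Properties hiding (suc-injective)
  open import Data.Nat.DivMod
  open import Data.Fin using (Fin; zero; suc; toℕ; inject₁; fromℕ)
  open import Data.Fin.Properties using (toℕ-injective; toℕ<n; toℕ-inject₁; toℕ-fromℕ; suc-injective)
  open import Data.Product using (∃; _×_; _,_)
  open import Relation.Nullary using (yes; no; contradiction)
  open import Relation.Binary.PropositionalEquality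

  data LastOrInject₁ {n} : Fin (suc n) → Set where
    last : LastOrInject₁ (fromℕ n)
    inj  : (i : Fin n) → LastOrInject₁ (inject₁ i)

  lastOrInject₁ : ∀ {n} (x : Fin (suc n)) → LastOrInject₁ x
  lastOrInject₁ {zero}  zero    = last
  lastOrInject₁ {suc n} zero    = inj zero
  lastOrInject₁ {suc n} (suc x) with lastOrInject₁ x
  ... | last  = last
  ... | inj i = inj (suc i)

  cyc-inject₁ : ∀ {n} (i : Fin n) → cyc (inject₁ i) ≡ suc i
  cyc-inject₁ {suc n} zero    = refl
  cyc-inject₁ {suc n} (suc i) rewrite cyc-inject₁ i = refl

  cyc-fromℕ : ∀ n → cyc (fromℕ n) ≡ zero
  cyc-fromℕ zero    = refl
  cyc-fromℕ (suc n) rewrite cyc-fromℕ n = refl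

  toℕ-cyc : ∀ {n} (x : Fin (suc n)) → toℕ (cyc x) ≡ (toℕ x + 1) % suc n
  toℕ-cyc {n} x with lastOrInject₁ x
  ... | last rewrite cyc-fromℕ n | toℕ-fromℕ n | +-comm n 1 = sym (n%n≡0 (suc n))
  ... | inj i rewrite cyc-inject₁ i | toℕ-inject₁ i | +-comm (toℕ i) 1 =
    sym (m<n⇒m%n≡m (s≤s (toℕ<n i)))

  cyc-injective : ∀ {n} {x y : Fin (suc n)} → cyc x ≡ cyc y → x ≡ y
  cyc-injective {n} {x} {y} eq with lastOrInject₁ x | lastOrInject₁ y
  ... | last  | last  = refl
  ... | last  | inj j rewrite cyc-fromℕ n | cyc-inject₁ j = contradiction eq λ ()
  ... | inj i | last  rewrite cyc-fromℕ n | cyc-inject₁ i = contradiction eq λ ()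
  ... | inj i | inj j rewrite cyc-inject₁ i | cyc-inject₁ j = cong inject₁ (suc-injective eq)

  cyc-surjective : ∀ {n} (y : Fin (suc n)) → ∃ λ x → cyc x ≡ y
  cyc-surjective {n}     zero    = fromℕ n , cyc-fromℕ n
  cyc-surjective {suc n} (suc j) = inject₁ j , cyc-inject₁ j

  rot : ∀ {n} → ℕ → Fin (suc n) → Fin (suc n)
  rot zero    x = x
  rot (suc m) x = rot m (cyc x)

  toℕ-rot : ∀ {n} m (x : Fin (suc n)) → toℕ (rot m x) ≡ (toℕ x + m) % suc n
  toℕ-rot {n} zero x rewrite +-identityʳ (toℕ x) = sym (m<n⇒m%n≡m (toℕ<n x))
  toℕ-rot {n} (suc m) x = begin
      toℕ (rot m (cyc x))                 ≡⟨ toℕ-rot m (cyc x) ⟩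
      (toℕ (cyc x) + m) % N               ≡⟨ cong (λ z → (z + m) % N) (toℕ-cyc x) ⟩
      ((toℕ x + 1) % N + m) % N           ≡⟨ %-distribˡ-+ ((toℕ x + 1) % N) m N ⟩
      ((toℕ x + 1) % N % N + m % N) % N   ≡⟨ cong (λ z → (z + m % N) % N) (m%n%n≡m%n (toℕ x + 1) N) ⟩
      ((toℕ x + 1) % N + m % N) % N       ≡⟨ %-distribˡ-+ (toℕ x + 1) m N ⟨
      (toℕ x + 1 + m) % N                 ≡⟨ cong (_% N) (+-assoc (toℕ x) 1 m) ⟩
      (toℕ x + suc m) % N                 ∎
    where
    open ≡-Reasoning
    N = suc n

  [t+d]%N≢t : ∀ N .{{_ : NonZero N}} t d → t < N → 0 < d → d < N → (t + d) % N ≢ t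
  [t+d]%N≢t N t d t<N 0<d d<N eq with t + d <? N
  ... | yes t+d<N rewrite m<n⇒m%n≡m t+d<N = <-irrefl refl (subst (t <_) eq (m<m+n t 0<d))
  ... | no  t+d≮N = <-irrefl refl (subst (_< N) d≡N d<N)
    where
    s = t + d ∸ N
    t+d≡s+N : t + d ≡ s + N
    t+d≡s+N = sym (m∸n+n≡m (≮⇒≥ t+d≮N))
    s<N : s < N
    s<N = +-cancelʳ-< _ _ N (subst (_< N + N) t+d≡s+N (+-mono-< t<N d<N))
    s≡t : s ≡ t
    s≡t = begin
      s             ≡⟨ m<n⇒m%n≡m s<N ⟨
      s % N         ≡⟨ [m+n]%n≡m%n s N ⟨
      (s + N) % N   ≡⟨ cong (_% N) t+d≡s+N ⟨
      (t + d) % N   ≡⟨ eq ⟩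
      t             ∎
      where open ≡-Reasoning
    d≡N : d ≡ N
    d≡N = +-cancelˡ-≡ t _ _ (trans t+d≡s+N (cong (_+ N) s≡t))

  rot-no-fixpoint : ∀ {n} d (x : Fin (suc n)) → 0 < d → d < suc n → rot d x ≢ x
  rot-no-fixpoint {n} d x 0<d d<N eq =
    [t+d]%N≢t (suc n) (toℕ x) d (toℕ<n x) 0<d d<N (trans (sym (toℕ-rot d x)) (cong toℕ eq))

  cyc-no-fixpoint : ∀ {n} (x : Fin (2 + n)) → cyc x ≢ x
  cyc-no-fixpoint x = rot-no-fixpoint 1 x (s≤s z≤n) (s≤s (s≤s z≤n))

  cyc²-no-fixpoint : ∀ {n} (x : Fin (3 + n)) → cyc (cyc x) ≢ x
  cyc²-no-fixpoint x = rot-no-fixpoint 2 x (s≤s z≤n) (s≤s (s≤s (s≤s z≤n)))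

  rot-period : ∀ {n} (x : Fin (suc n)) → rot (suc n) x ≡ x
  rot-period {n} x = toℕ-injective (begin
    toℕ (rot (suc n) x)      ≡⟨ toℕ-rot (suc n) x ⟩
    (toℕ x + suc n) % suc n  ≡⟨ [m+n]%n≡m%n (toℕ x) (suc n) ⟩
    toℕ x % suc n            ≡⟨ m<n⇒m%n≡m (toℕ<n x) ⟩
    toℕ x                    ∎)
    where open ≡-Reasoning

  rot-from-zero : ∀ {n} (i : Fin (suc n)) → rot (toℕ i) zero ≡ i
  rot-from-zero i = toℕ-injective (trans (toℕ-rot (toℕ i) zero) (m<n⇒m%n≡m (toℕ<n i)))

  rot-surjective : ∀ {n} (y z : Fin (suc n)) → ∃ λ j → j < suc n × rot j y ≡ z
  rot-surjective {n} y z = j , m%n<n (toℕ z + N ∸ toℕ y) N , toℕ-injective (begin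
      toℕ (rot j y)                                  ≡⟨ toℕ-rot j y ⟩
      (toℕ y + j) % N                                ≡⟨ %-distribˡ-+ (toℕ y) j N ⟩
      (toℕ y % N + (toℕ z + N ∸ toℕ y) % N % N) % N  ≡⟨ cong (λ w → (toℕ y % N + w) % N) (m%n%n≡m%n (toℕ z + N ∸ toℕ y) N) ⟩
      (toℕ y % N + (toℕ z + N ∸ toℕ y) % N) % N      ≡⟨ %-distribˡ-+ (toℕ y) (toℕ z + N ∸ toℕ y) N ⟨
      (toℕ y + (toℕ z + N ∸ toℕ y)) % N              ≡⟨ cong (_% N) (m+[n∸m]≡n y≤z+N) ⟩
      (toℕ z + N) % N                                ≡⟨ [m+n]%n≡m%n (toℕ z) N ⟩
      toℕ z % N                                      ≡⟨ m<n⇒m%n≡m (toℕ<n z) ⟩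
      toℕ z                                          ∎)
    where
    open ≡-Reasoning
    N = suc n
    j = (toℕ z + N ∸ toℕ y) % N
    y≤z+N : toℕ y ≤ toℕ z + N
    y≤z+N = ≤-trans (<⇒≤ (toℕ<n y)) (m≤n+m N (toℕ z))

  cyc-invariant⇒constant : ∀ {n} {A : Set} (d : Fin (suc n) → A) → (∀ i → d (cyc i) ≡ d i) → ∀ i → d i ≡ d zero
  cyc-invariant⇒constant d d-cyc i = trans (cong d (sym (rot-from-zero i))) (rot-invariant (toℕ i) zero)
    where
    rot-invariant : ∀ m x → d (rot m x) ≡ d x
    rot-invariant zero    x = refl
    rot-invariant (suc m) x = trans (rot-invariant m (cyc x)) (d-cyc x)

module ParityFacts where
  open CyclicOrder using (cyc-injective)
  open import Data.Nat using (suc)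
  open import Data.Bool using (Bool; true; false; _xor_)
  open import Data.Fin using (Fin; _≟_)
  open import Data.Sum using (_⊎_; inj₁; inj₂)
  open import Relation.Nullary using (yes; no; does; contradiction)
  open import Relation.Binary.PropositionalEquality

  _=ᵇ_ : ∀ {n} → Fin n → Fin n → Bool
  x =ᵇ y = does (x ≟ y)

  =ᵇ-sym : ∀ {n} (x y : Fin n) → (x =ᵇ y) ≡ (y =ᵇ x)
  =ᵇ-sym x y with x ≟ y | y ≟ x
  ... | yes _   | yes _   = refl
  ... | no _    | no _    = refl
  ... | yes x≡y | no y≢x  = contradiction (sym x≡y) y≢x
  ... | no x≢y  | yes y≡x = contradiction (sym y≡x) x≢y

  =ᵇ-cyc : ∀ {n} (x y : Fin (suc n)) → (cyc x =ᵇ cyc y) ≡ (x =ᵇ y)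
  =ᵇ-cyc x y with cyc x ≟ cyc y | x ≟ y
  ... | yes _  | yes _   = refl
  ... | no _   | no _    = refl
  ... | yes eq | no x≢y  = contradiction (cyc-injective eq) x≢y
  ... | no neq | yes x≡y = contradiction (cong cyc x≡y) neq

  =ᵇ-refl : ∀ {n} (x : Fin n) → (x =ᵇ x) ≡ true
  =ᵇ-refl x with x ≟ x
  ... | yes _  = refl
  ... | no x≢x = contradiction refl x≢x

  ≢⇒=ᵇfalse : ∀ {n} {x y : Fin n} → x ≢ y → (x =ᵇ y) ≡ false
  ≢⇒=ᵇfalse {x = x} {y} x≢y with x ≟ y
  ... | yes x≡y = contradiction x≡y x≢y
  ... | no _    = refl

  xor-interchange : ∀ a b c d → (a xor b) xor (c xor d) ≡ (a xor c) xor (b xor d)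
  xor-interchange false false c     d     = refl
  xor-interchange false true  false d     = refl
  xor-interchange false true  true  d     = refl
  xor-interchange true  false false d     = refl
  xor-interchange true  false true  false = refl
  xor-interchange true  false true  true  = refl
  xor-interchange true  true  false false = refl
  xor-interchange true  true  false true  = refl
  xor-interchange true  true  true  false = refl
  xor-interchange true  true  true  true  = refl

  xor-cancel-middle : ∀ a b c → (a xor b) xor (b xor c) ≡ a xor c
  xor-cancel-middle false false c     = refl
  xor-cancel-middle false true  false = refl
  xor-cancel-middle false true  true  = refl
  xor-cancel-middle true  false c     = refl
  xor-cancel-middle true  true  false = refl
  xor-cancel-middle true  true  true  = refl

  xor≡false⇒≡ : ∀ a b → a xor b ≡ false → b ≡ a
  xor≡false⇒≡ false false _ = refl
  xor≡false⇒≡ true  true  _ = refl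

  xor≡true⇒⊎ : ∀ a b → a xor b ≡ true → a ≡ true ⊎ b ≡ true
  xor≡true⇒⊎ true  b    _ = inj₁ refl
  xor≡true⇒⊎ false true _ = inj₂ refl

  xor-transpose : ∀ a b c d → a xor b ≡ c xor d → a xor c ≡ b xor d
  xor-transpose false false false false _ = refl
  xor-transpose false false true  true  _ = refl
  xor-transpose false true  false true  _ = refl
  xor-transpose false true  true  false _ = refl
  xor-transpose true  false false true  _ = refl
  xor-transpose true  false true  false _ = refl
  xor-transpose true  true  false false _ = refl
  xor-transpose true  true  true  true  _ = refl
  xor-transpose false false false true  ()
  xor-transpose false false true  false ()
  xor-transpose false true  false false ()
  xor-transpose false true  true  true  ()
  xor-transpose true  false false false ()
  xor-transpose true  false true  true  ()
  xor-transpose true  true  false true  ()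
  xor-transpose true  true  true  false ()

module DeltaGraph (k : ℕ) where
  open SubsetFacts
  open CyclicOrder
  open ParityFacts
  open import Data.Nat using (zero; suc; _+_; _≤_; _<_; _≥_; z≤n; s≤s)
  open import Data.Nat.Properties using (<-trans; n<1+n; ≤-<-trans; ≤∧≢⇒<; ≤-pred)
  open import Data.Bool using (Bool; true; false; _xor_; not)
  open import Data.Bool.Properties using (xor-same; xor-comm)
  open import Data.Fin using (Fin; zero; suc; _≟_; _↑ˡ_; _↑ʳ_; splitAt)
  open import Data.Fin.Properties using (splitAt-↑ˡ; splitAt-↑ʳ; splitAt⁻¹-↑ˡ; splitAt⁻¹-↑ʳ; any?)
  open import Data.Fin.Subset using (Subset; _∈_; _∉_; _∪_; Nonempty; ⁅_⁆; ⋃)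
  open import Data.Fin.Subset.Properties using (x∈p∪q⁺; x∈p∪q⁻; ⊆-antisym; _∈?_)
  open import Data.List using (List; []; _∷_; length; map)
  import Data.List.Membership.Propositional as List
  open import Data.List.Relation.Unary.Any using (here; there)
  open import Data.List.Relation.Unary.All as All using ([]; _∷_)
  open import Data.List.Relation.Unary.AllPairs using (AllPairs; []; _∷_)
  open import Data.Product using (Σ; ∃; _×_; _,_; proj₁; proj₂)
  open import Data.Sum using (_⊎_; inj₁; inj₂)
  import Data.Sum as Sum
  open import Data.Empty using (⊥; ⊥-elim)
  open import Relation.Nullary using (¬_; yes; no; contradiction)
  open import Relation.Nullary.Decidable using (_×-dec_; ¬?; decidable-stable)
  open import Relation.Binary.PropositionalEquality

  N : ℕ
  N = 3 + k

  Vertex Edge : Set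
  Vertex = Fin N
  Edge   = Fin (N + N)

  G : Graph N (N + N)
  G = Δ k

  leg : Edge → Vertex
  leg = pairEnds

  edge₁ edge₂ : Vertex → Edge
  edge₁ i = i ↑ˡ N
  edge₂ i = N ↑ʳ i

  partner : Edge → Edge
  partner e with splitAt N e
  ... | inj₁ i = edge₂ i
  ... | inj₂ i = edge₁ i

  data EdgeView : Edge → Set where
    first  : ∀ i → EdgeView (edge₁ i)
    second : ∀ i → EdgeView (edge₂ i)

  edgeView : ∀ e → EdgeView e
  edgeView e with splitAt N e in eq
  ... | inj₁ i = subst EdgeView (splitAt⁻¹-↑ˡ eq) (first i)
  ... | inj₂ i = subst EdgeView (splitAt⁻¹-↑ʳ eq) (second i)

  leg-edge₁ : ∀ i → leg (edge₁ i) ≡ i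
  leg-edge₁ i rewrite splitAt-↑ˡ N i N = refl

  leg-edge₂ : ∀ i → leg (edge₂ i) ≡ i
  leg-edge₂ i rewrite splitAt-↑ʳ N N i = refl

  partner-edge₁ : ∀ i → partner (edge₁ i) ≡ edge₂ i
  partner-edge₁ i rewrite splitAt-↑ˡ N i N = refl

  partner-edge₂ : ∀ i → partner (edge₂ i) ≡ edge₁ i
  partner-edge₂ i rewrite splitAt-↑ʳ N N i = refl

  edge₁≢edge₂ : ∀ i j → edge₁ i ≢ edge₂ j
  edge₁≢edge₂ i j eq with trans (sym (splitAt-↑ˡ N i N)) (trans (cong (splitAt N) eq) (splitAt-↑ʳ N N j))
  ... | ()

  partner-involutive : ∀ e → partner (partner e) ≡ e
  partner-involutive e with edgeView e
  ... | first i  rewrite partner-edge₁ i | partner-edge₂ i = refl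
  ... | second i rewrite partner-edge₂ i | partner-edge₁ i = refl

  partner-injective : ∀ {x y} → partner x ≡ partner y → x ≡ y
  partner-injective {x} {y} eq = trans (sym (partner-involutive x)) (trans (cong partner eq) (partner-involutive y))

  partner-sym : ∀ {x y} → partner x ≡ y → partner y ≡ x
  partner-sym {x} eq = trans (cong partner (sym eq)) (partner-involutive x)

  partner-≢ : ∀ e → partner e ≢ e
  partner-≢ e eq with edgeView e
  ... | first i  rewrite partner-edge₁ i = edge₁≢edge₂ i i (sym eq)
  ... | second i rewrite partner-edge₂ i = edge₁≢edge₂ i i eq

  leg-partner : ∀ e → leg (partner e) ≡ leg e
  leg-partner e with edgeView e
  ... | first i  rewrite partner-edge₁ i | leg-edge₁ i | leg-edge₂ i = refl
  ... | second i rewrite partner-edge₂ i | leg-edge₁ i | leg-edge₂ i = refl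

  leg≡⇒edge₁⊎edge₂ : ∀ e i → leg e ≡ i → e ≡ edge₁ i ⊎ e ≡ edge₂ i
  leg≡⇒edge₁⊎edge₂ e i eq with edgeView e
  ... | first j  rewrite leg-edge₁ j | eq = inj₁ refl
  ... | second j rewrite leg-edge₂ j | eq = inj₂ refl

  same-leg : ∀ x e → leg x ≡ leg e → x ≡ e ⊎ x ≡ partner e
  same-leg x e eq with edgeView e
  ... | first i  rewrite leg-edge₁ i | partner-edge₁ i = leg≡⇒edge₁⊎edge₂ x i eq
  ... | second i rewrite leg-edge₂ i | partner-edge₂ i = Sum.swap (leg≡⇒edge₁⊎edge₂ x i eq)

  legParity : List Edge → Vertex → Bool
  legParity []      i = false
  legParity (e ∷ l) i = (leg e =ᵇ i) xor legParity l i

  joins-=ᵇ : ∀ e {x z} → Joins G e x z → ∀ i →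
             (leg e =ᵇ i) xor (leg e =ᵇ cyc i) ≡ (cyc i =ᵇ x) xor (cyc i =ᵇ z)
  joins-=ᵇ e (inj₁ refl) i rewrite =ᵇ-cyc i (leg e) | =ᵇ-sym (leg e) (cyc i) | =ᵇ-sym i (leg e) =
    xor-comm (leg e =ᵇ i) (cyc i =ᵇ leg e)
  joins-=ᵇ e (inj₂ refl) i rewrite =ᵇ-cyc i (leg e) | =ᵇ-sym (leg e) (cyc i) | =ᵇ-sym i (leg e) = refl

  -- Legs i and cyc i are exactly the edges at vertex cyc i, which a walk enters and leaves equally often
  -- except at its ends.
  legParity-walk : ∀ {u v} (w : Walk G u v) i →
                   legParity (edges w) i xor legParity (edges w) (cyc i) ≡ (cyc i =ᵇ u) xor (cyc i =ᵇ v)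
  legParity-walk {u} []                       i = sym (xor-same (cyc i =ᵇ u))
  legParity-walk {u} {v} (step {z = z} e j w) i = begin
    ((leg e =ᵇ i) xor legParity (edges w) i) xor ((leg e =ᵇ cyc i) xor legParity (edges w) (cyc i))
      ≡⟨ xor-interchange (leg e =ᵇ i) (legParity (edges w) i) (leg e =ᵇ cyc i) (legParity (edges w) (cyc i)) ⟩
    ((leg e =ᵇ i) xor (leg e =ᵇ cyc i)) xor (legParity (edges w) i xor legParity (edges w) (cyc i))
      ≡⟨ cong₂ _xor_ (joins-=ᵇ e j i) (legParity-walk w i) ⟩
    ((cyc i =ᵇ u) xor (cyc i =ᵇ z)) xor ((cyc i =ᵇ z) xor (cyc i =ᵇ v))
      ≡⟨ xor-cancel-middle (cyc i =ᵇ u) (cyc i =ᵇ z) (cyc i =ᵇ v) ⟩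
    (cyc i =ᵇ u) xor (cyc i =ᵇ v) ∎
    where open ≡-Reasoning

  legParity-closed : ∀ {x} (w : Walk G x x) i → legParity (edges w) i ≡ legParity (edges w) zero
  legParity-closed {x} w = cyc-invariant⇒constant (legParity (edges w)) λ i →
    xor≡false⇒≡ _ _ (trans (legParity-walk w i) (xor-same (cyc i =ᵇ x)))

  legParity≡true⇒ : ∀ l i → legParity l i ≡ true → ∃ λ e → e List.∈ l × leg e ≡ i
  legParity≡true⇒ (e ∷ l) i odd with leg e ≟ i
  ... | yes eq = e , here refl , eq
  ... | no _ with legParity≡true⇒ l i odd
  ...   | e′ , e′∈ , eq = e′ , there e′∈ , eq

  legParity≡false : ∀ l i → (∀ e → e List.∈ l → leg e ≢ i) → legParity l i ≡ false
  legParity≡false []      i _    = refl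
  legParity≡false (e ∷ l) i none with leg e ≟ i
  ... | yes eq = contradiction eq (none e (here refl))
  ... | no _   = legParity≡false l i (λ e′ e′∈ → none e′ (there e′∈))

  legParity-unpartnered : ∀ l → AllPairs _≢_ l → ∀ e → e List.∈ l → partner e List.∉ l →
                          legParity l (leg e) ≡ true
  legParity-unpartnered (h ∷ l) (h∉ ∷ u) e (here refl) p∉ rewrite =ᵇ-refl (leg h) =
    cong not (legParity≡false l (leg h) λ e′ e′∈ eq → off-leg e′∈ (same-leg e′ h eq))
    where
    off-leg : ∀ {e′} → e′ List.∈ l → ¬ (e′ ≡ h ⊎ e′ ≡ partner h)
    off-leg e′∈ (inj₁ refl) = All.lookup h∉ e′∈ refl
    off-leg e′∈ (inj₂ refl) = p∉ (there e′∈)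
  legParity-unpartnered (h ∷ l) (h∉ ∷ u) e (there e∈) p∉ with leg h ≟ leg e
  ... | no _  = legParity-unpartnered l u e e∈ (λ p∈ → p∉ (there p∈))
  ... | yes eq with same-leg h e eq
  ...   | inj₁ refl = contradiction refl (All.lookup h∉ e∈)
  ...   | inj₂ refl = contradiction (here refl) p∉

  ∈-verts-start : ∀ {x y} (w : Walk G x y) → x List.∈ verts w
  ∈-verts-start []           = here refl
  ∈-verts-start (step e j w) = here refl

  ∈-verts-end : ∀ {x y} (w : Walk G x y) → y List.∈ verts w
  ∈-verts-end []           = here refl
  ∈-verts-end (step e j w) = there (∈-verts-end w)

  ends-∈-verts : ∀ {x y} (w : Walk G x y) e → e List.∈ edges w → leg e List.∈ verts w × cyc (leg e) List.∈ verts w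
  ends-∈-verts (step e (inj₁ refl) w) e (here refl) = here refl , there (∈-verts-start w)
  ends-∈-verts (step e (inj₂ refl) w) e (here refl) = there (∈-verts-start w) , here refl
  ends-∈-verts (step _ _ w) e (there e∈) with ends-∈-verts w e e∈
  ... | l∈ , c∈ = there l∈ , there c∈

  ∈-dropLast : ∀ {z v} (w : Walk G z v) y → y List.∈ verts w → y ≢ v → y List.∈ dropLast (verts w)
  ∈-dropLast []                         y (here refl)         y≢v = contradiction refl y≢v
  ∈-dropLast (step e j [])              y (here refl)         y≢v = here refl
  ∈-dropLast (step e j (step e′ j′ w))  y (here refl)         y≢v = here refl
  ∈-dropLast (step e j [])              y (there (here refl)) y≢v = contradiction refl y≢v
  ∈-dropLast (step e j (step e′ j′ w))  y (there y∈)          y≢v = there (∈-dropLast (step e′ j′ w) y y∈ y≢v)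

  ∈-internal : ∀ {u v} (w : Walk G u v) y → y List.∈ verts w → y ≢ u → y ≢ v → y List.∈ internal w
  ∈-internal []           y (here refl) y≢u y≢v = contradiction refl y≢u
  ∈-internal (step e j w) y (here refl) y≢u y≢v = contradiction refl y≢u
  ∈-internal (step e j w) y (there y∈) y≢u y≢v = ∈-dropLast w y y∈ y≢v

  ∈-edgeSet⁺ : ∀ {x y} (w : Walk G x y) {e} → e List.∈ edges w → e ∈ edgeSet w
  ∈-edgeSet⁺ w = ∈-⋃⁅⁆⁺ (edges w)

  ∈-edgeSet⁻ : ∀ {x y} (w : Walk G x y) {e} → e ∈ edgeSet w → e List.∈ edges w
  ∈-edgeSet⁻ w = ∈-⋃⁅⁆⁻ (edges w)

  JoinsEnds : Edge → Vertex → Vertex → Set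
  JoinsEnds e u v = (leg e ≡ u × cyc (leg e) ≡ v) ⊎ (leg e ≡ v × cyc (leg e) ≡ u)

  path-with-direct-edge : ∀ {u v} (w : Walk G u v) → IsPath w → u ≢ v → ∀ e → e List.∈ edges w →
                          JoinsEnds e u v → edges w ≡ e ∷ []
  path-with-direct-edge (step e₁ j w) (u∉ ∷ _) u≢v e (there e∈) ends with ends-∈-verts w e e∈ | ends
  ... | l∈ , c∈ | inj₁ (l≡u , _) = contradiction (sym l≡u) (All.lookup u∉ l∈)
  ... | l∈ , c∈ | inj₂ (_ , c≡u) = contradiction (sym c≡u) (All.lookup u∉ c∈)
  path-with-direct-edge {u} {v} (step {z = z} e j w) (_ ∷ unique) u≢v e (here refl) ends =
    cong (e ∷_) (no-more-edges w unique (second-end j ends))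
    where
    second-end : Joins G e u z → JoinsEnds e u v → z ≡ v
    second-end (inj₁ eq) (inj₁ (_ , c≡v)) = trans (sym (cong proj₂ eq)) c≡v
    second-end (inj₁ eq) (inj₂ (l≡v , _)) = contradiction (trans (sym (cong proj₁ eq)) l≡v) u≢v
    second-end (inj₂ eq) (inj₁ (_ , c≡v)) = contradiction (trans (sym (cong proj₂ eq)) c≡v) u≢v
    second-end (inj₂ eq) (inj₂ (l≡v , _)) = trans (sym (cong proj₁ eq)) l≡v
    no-more-edges : ∀ {z} (w′ : Walk G z v) → AllPairs _≢_ (verts w′) → z ≡ v → edges w′ ≡ []
    no-more-edges []              _       _    = refl
    no-more-edges (step e′ j′ w″) (z∉ ∷ _) refl = contradiction refl (All.lookup z∉ (∈-verts-end w″))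

  LegClosed : Subset (N + N) → Set
  LegClosed C = ∀ e → e ∈ C → partner e ∈ C

  MeetsAllLegs : Subset (N + N) → Set
  MeetsAllLegs C = ∀ e → e ∈ C ⊎ partner e ∈ C

  TwoLegs : Subset (N + N) → Set
  TwoLegs C = Σ Edge λ e → Σ Edge λ e′ → e ∈ C × e′ ∈ C × leg e ≢ leg e′

  legClosed-∋ : ∀ {C g h} → LegClosed C → g ∈ C → h ≡ g ⊎ h ≡ partner g → h ∈ C
  legClosed-∋ closed g∈ (inj₁ refl) = g∈
  legClosed-∋ closed g∈ (inj₂ refl) = closed _ g∈

  legClosed-same-leg : ∀ {C g h} → LegClosed C → g ∈ C → leg h ≡ leg g → h ∈ C
  legClosed-same-leg {h = h} closed g∈ eq = legClosed-∋ closed g∈ (same-leg h _ eq)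

  cycle-legClosed⊎meetsAllLegs : ∀ C → IsCycle G C → (LegClosed C × Nonempty C) ⊎ MeetsAllLegs C
  cycle-legClosed⊎meetsAllLegs C (x , w , (len , unique , _) , refl) with legParity (edges w) zero in parity₀
  ... | true  = inj₂ λ e → meets e (legParity≡true⇒ (edges w) (leg e) (trans (legParity-closed w (leg e)) parity₀))
    where
    meets : ∀ e → (∃ λ e′ → e′ List.∈ edges w × leg e′ ≡ leg e) → e ∈ edgeSet w ⊎ partner e ∈ edgeSet w
    meets e (e′ , e′∈ , eq) with same-leg e′ e eq
    ... | inj₁ refl = inj₁ (∈-edgeSet⁺ w e′∈)
    ... | inj₂ refl = inj₂ (∈-edgeSet⁺ w e′∈)
  ... | false = inj₁ (closed , nonempty w len)
    where
    closed : LegClosed (edgeSet w)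
    closed e e∈ = decidable-stable (partner e ∈? edgeSet w) λ p∉ →
      contradiction (trans (sym (legParity-unpartnered (edges w) unique e (∈-edgeSet⁻ w e∈) (λ p∈ → p∉ (∈-edgeSet⁺ w p∈))))
                           (trans (legParity-closed w (leg e)) parity₀)) λ ()
    nonempty : ∀ {y} (w : Walk G y y) → length (edges w) ≥ 1 → Nonempty (edgeSet w)
    nonempty (step e j w) _ = e , ∈-edgeSet⁺ (step e j w) (here refl)

  legParity-agree : ∀ {u v} (P Q : Walk G u v) j → legParity (edges P) j ≡ legParity (edges Q) j →
                    ∀ i → legParity (edges Q) i ≡ legParity (edges P) i
  legParity-agree P Q j agree i = xor≡false⇒≡ _ _ (trans (difference-constant i) difference₀)
    where
    difference : Vertex → Bool
    difference i = legParity (edges P) i xor legParity (edges Q) i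
    difference-constant : ∀ i → difference i ≡ difference zero
    difference-constant = cyc-invariant⇒constant difference λ i → sym (xor-transpose
      (legParity (edges P) i) (legParity (edges P) (cyc i)) (legParity (edges Q) i) (legParity (edges Q) (cyc i))
      (trans (legParity-walk P i) (sym (legParity-walk Q i))))
    difference₀ : difference zero ≡ false
    difference₀ = trans (sym (difference-constant j)) (trans (cong (_xor legParity (edges Q) j) agree) (xor-same (legParity (edges Q) j)))

  legParity-odd : ∀ {u v} (P : Walk G u v) → u ≢ v → ∃ λ i → legParity (edges P) i ≡ true
  legParity-odd {u} {v} P u≢v with cyc-surjective u
  ... | i , cyc-i≡u with xor≡true⇒⊎ _ _ (trans (legParity-walk P i)
                           (subst (λ y → (y =ᵇ u) xor (y =ᵇ v) ≡ true) (sym cyc-i≡u) (cong₂ _xor_ (=ᵇ-refl u) (≢⇒=ᵇfalse u≢v))))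
  ...   | inj₁ odd = i , odd
  ...   | inj₂ odd = cyc i , odd

  -- Off the legs it misses, the three paths of a theta have equal leg parities; as their ends differ some
  -- leg is used oddly by all three, and two of them share an edge of that leg, which is impossible.
  theta-meetsAllLegs : ∀ T → IsTheta G T → MeetsAllLegs T
  theta-meetsAllLegs T (u , v , u≢v , P₁ , P₂ , P₃ , path₁ , path₂ , path₃ , disj₁₂ , _ , _ , P₁≢P₂ , P₁≢P₃ , P₂≢P₃ , refl) e
    with e ∈? T | partner e ∈? T
  ... | yes e∈ | _      = inj₁ e∈
  ... | no _   | yes p∈ = inj₂ p∈
  ... | no e∉  | no p∉  = ⊥-elim (odd-on-all (legParity-odd P₁ u≢v))
    where
    off-leg : ∀ {e′} → e′ ∈ T → leg e′ ≢ leg e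
    off-leg {e′} e′∈ eq with same-leg e′ e eq
    ... | inj₁ refl = e∉ e′∈
    ... | inj₂ refl = p∉ e′∈
    even-off : ∀ (P : Walk G u v) → (∀ {e′} → e′ List.∈ edges P → e′ ∈ T) → legParity (edges P) (leg e) ≡ false
    even-off P ⊆T = legParity≡false (edges P) (leg e) λ e′ e′∈ → off-leg (⊆T e′∈)
    even₁ = even-off P₁ λ e′∈ → x∈p∪q⁺ (inj₁ (∈-edgeSet⁺ P₁ e′∈))
    same₂ = legParity-agree P₁ P₂ (leg e) (trans even₁ (sym (even-off P₂ λ e′∈ → x∈p∪q⁺ (inj₂ (x∈p∪q⁺ (inj₁ (∈-edgeSet⁺ P₂ e′∈)))))))
    same₃ = legParity-agree P₁ P₃ (leg e)
      (trans even₁ (sym (even-off P₃ λ e′∈ → x∈p∪q⁺ {p = edgeSet P₁} (inj₂ (x∈p∪q⁺ (inj₂ (∈-edgeSet⁺ P₃ e′∈)))))))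
    edgeSet-single : ∀ (P Q : Walk G u v) {x} → edges P ≡ x ∷ [] → edges Q ≡ x ∷ [] → edgeSet P ≡ edgeSet Q
    edgeSet-single P Q P≡ Q≡ = trans (cong (λ l → ⋃ (map ⁅_⁆ l)) P≡) (sym (cong (λ l → ⋃ (map ⁅_⁆ l)) Q≡))
    odd-on-all : (∃ λ i → legParity (edges P₁) i ≡ true) → ⊥
    odd-on-all (i , odd) with legParity≡true⇒ (edges P₁) i odd
                            | legParity≡true⇒ (edges P₂) i (trans (same₂ i) odd)
                            | legParity≡true⇒ (edges P₃) i (trans (same₃ i) odd)
    ... | x₁ , x₁∈ , l₁ | x₂ , x₂∈ , l₂ | x₃ , x₃∈ , l₃ = ends-of-x₁
      where
      common-internal : ∀ y → y ≢ u → y ≢ v → y List.∈ verts P₁ → y List.∈ verts P₂ → ⊥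
      common-internal y y≢u y≢v y∈₁ y∈₂ = disj₁₂ y (∈-internal P₁ y y∈₁ y≢u y≢v) (∈-internal P₂ y y∈₂ y≢u y≢v)
      direct : ¬ JoinsEnds x₁ u v
      direct ends = pigeonhole (leg≡⇒edge₁⊎edge₂ x₁ i l₁) (leg≡⇒edge₁⊎edge₂ x₂ i l₂) (leg≡⇒edge₁⊎edge₂ x₃ i l₃)
        where
        ends′ : ∀ {x} → leg x ≡ i → JoinsEnds x u v
        ends′ eq rewrite eq | sym l₁ = ends
        single₁ = path-with-direct-edge P₁ path₁ u≢v x₁ x₁∈ (ends′ {x₁} l₁)
        single₂ = path-with-direct-edge P₂ path₂ u≢v x₂ x₂∈ (ends′ {x₂} l₂)
        single₃ = path-with-direct-edge P₃ path₃ u≢v x₃ x₃∈ (ends′ {x₃} l₃)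
        pigeonhole : x₁ ≡ edge₁ i ⊎ x₁ ≡ edge₂ i → x₂ ≡ edge₁ i ⊎ x₂ ≡ edge₂ i →
                     x₃ ≡ edge₁ i ⊎ x₃ ≡ edge₂ i → ⊥
        pigeonhole (inj₁ refl) (inj₁ refl) _ = P₁≢P₂ (edgeSet-single P₁ P₂ single₁ single₂)
        pigeonhole (inj₂ refl) (inj₂ refl) _ = P₁≢P₂ (edgeSet-single P₁ P₂ single₁ single₂)
        pigeonhole (inj₁ refl) _ (inj₁ refl) = P₁≢P₃ (edgeSet-single P₁ P₃ single₁ single₃)
        pigeonhole (inj₂ refl) _ (inj₂ refl) = P₁≢P₃ (edgeSet-single P₁ P₃ single₁ single₃)
        pigeonhole _ (inj₁ refl) (inj₁ refl) = P₂≢P₃ (edgeSet-single P₂ P₃ single₂ single₃)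
        pigeonhole _ (inj₂ refl) (inj₂ refl) = P₂≢P₃ (edgeSet-single P₂ P₃ single₂ single₃)
      x₁∈₁ = ends-∈-verts P₁ x₁ x₁∈
      x₂∈₂ = ends-∈-verts P₂ x₂ x₂∈
      ends-of-x₁ : ⊥
      ends-of-x₁ with leg x₁ ≟ u | leg x₁ ≟ v | cyc (leg x₁) ≟ u | cyc (leg x₁) ≟ v
      ... | no l≢u  | no l≢v  | _       | _       = common-internal (leg x₁) l≢u l≢v (proj₁ x₁∈₁)
                                                     (subst (List._∈ verts P₂) (trans l₂ (sym l₁)) (proj₁ x₂∈₂))
      ... | _       | _       | no c≢u  | no c≢v  = common-internal (cyc (leg x₁)) c≢u c≢v (proj₂ x₁∈₁)
                                                     (subst (List._∈ verts P₂) (cong cyc (trans l₂ (sym l₁))) (proj₂ x₂∈₂))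
      ... | yes l≡u | _       | yes c≡u | _       = cyc-no-fixpoint (leg x₁) (trans c≡u (sym l≡u))
      ... | _       | yes l≡v | _       | yes c≡v = cyc-no-fixpoint (leg x₁) (trans c≡v (sym l≡v))
      ... | yes l≡u | _       | no _    | yes c≡v = direct (inj₁ (l≡u , c≡v))
      ... | no _    | yes l≡v | yes c≡u | _       = direct (inj₂ (l≡v , c≡u))

  vertexOf-oneLeg : ∀ {C v i} → (∀ e → e ∈ C → leg e ≡ i) → VertexOf G v C → v ≡ i ⊎ v ≡ cyc i
  vertexOf-oneLeg on-i (e , e∈ , inj₁ eq) = inj₁ (trans (sym eq) (on-i e e∈))
  vertexOf-oneLeg on-i (e , e∈ , inj₂ eq) = inj₂ (trans (sym eq) (cong cyc (on-i e e∈)))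

  oneLeg-¬spanning : ∀ C i → (∀ e → e ∈ C → leg e ≡ i) → ¬ (∀ v → VertexOf G v C)
  oneLeg-¬spanning C i on-i spanning =
    pigeonhole (vertexOf-oneLeg on-i (spanning v₀)) (vertexOf-oneLeg on-i (spanning v₁)) (vertexOf-oneLeg on-i (spanning v₂))
    where
    v₀ v₁ v₂ : Vertex
    v₀ = zero
    v₁ = suc zero
    v₂ = suc (suc zero)
    pigeonhole : v₀ ≡ i ⊎ v₀ ≡ cyc i → v₁ ≡ i ⊎ v₁ ≡ cyc i → v₂ ≡ i ⊎ v₂ ≡ cyc i → ⊥
    pigeonhole (inj₁ p) (inj₁ q) _ with trans p (sym q)
    ... | ()
    pigeonhole (inj₂ p) (inj₂ q) _ with trans p (sym q)
    ... | ()
    pigeonhole (inj₁ p) _ (inj₁ q) with trans p (sym q)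
    ... | ()
    pigeonhole (inj₂ p) _ (inj₂ q) with trans p (sym q)
    ... | ()
    pigeonhole _ (inj₁ p) (inj₁ q) with trans p (sym q)
    ... | ()
    pigeonhole _ (inj₂ p) (inj₂ q) with trans p (sym q)
    ... | ()

  data Shape (C : Subset (N + N)) : Set where
    unionOfLegs  : LegClosed C → TwoLegs C → Shape C
    meetsAllLegs : MeetsAllLegs C → Shape C

  module Lifted (B : Subset (N + N) → Set) (isSpike : IsSpikeClass k B) where

    balanced-hamiltonian : ∀ C → B C → IsHamiltonianCycle G C
    balanced-hamiltonian = proj₂ isSpike

    Circ : Subset (N + N) → Set
    Circ = Circuit (Lift G B)

    circuit-shape : ∀ C → Circ C → Shape C
    circuit-shape C (inj₂ (inj₁ (θ , _))) = meetsAllLegs (theta-meetsAllLegs C θ)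
    circuit-shape C (inj₁ balanced) with cycle-legClosed⊎meetsAllLegs C (proj₁ (balanced-hamiltonian C balanced))
    ... | inj₂ meets = meetsAllLegs meets
    ... | inj₁ (closed , x , x∈) with any? (λ y → (y ∈? C) ×-dec ¬? (leg y ≟ leg x))
    ...   | yes (y , y∈ , y≢x) = unionOfLegs closed (x , y , x∈ , y∈ , λ eq → y≢x (sym eq))
    ...   | no  none = contradiction (proj₂ (balanced-hamiltonian C balanced)) (oneLeg-¬spanning C (leg x) on-leg-x)
      where
      on-leg-x : ∀ e → e ∈ C → leg e ≡ leg x
      on-leg-x e e∈ = decidable-stable (leg e ≟ leg x) λ e≢x → none (e , e∈ , e≢x)
    circuit-shape C (inj₂ (inj₂ (C₁ , C₂ , cyc₁ , cyc₂ , _ , _ , C₁≢C₂ , _ , refl)))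
      with cycle-legClosed⊎meetsAllLegs C₁ cyc₁ | cycle-legClosed⊎meetsAllLegs C₂ cyc₂
    ... | inj₂ meets | _          = meetsAllLegs λ e → Sum.map (λ e∈ → x∈p∪q⁺ (inj₁ e∈)) (λ p∈ → x∈p∪q⁺ (inj₁ p∈)) (meets e)
    ... | inj₁ _     | inj₂ meets = meetsAllLegs λ e → Sum.map (λ e∈ → x∈p∪q⁺ (inj₂ e∈)) (λ p∈ → x∈p∪q⁺ (inj₂ p∈)) (meets e)
    ... | inj₁ (closed₁ , x₁ , x₁∈) | inj₁ (closed₂ , x₂ , x₂∈) = unionOfLegs closed twoLegs
      where
      closed : LegClosed (C₁ ∪ C₂)
      closed e e∈ with x∈p∪q⁻ C₁ C₂ e∈
      ... | inj₁ e∈₁ = x∈p∪q⁺ (inj₁ (closed₁ e e∈₁))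
      ... | inj₂ e∈₂ = x∈p∪q⁺ (inj₂ (closed₂ e e∈₂))
      twoLegs : TwoLegs (C₁ ∪ C₂)
      twoLegs with any? (λ y → (y ∈? C₁) ×-dec ¬? (y ∈? C₂)) | any? (λ y → (y ∈? C₂) ×-dec ¬? (y ∈? C₁))
      ... | yes (y , y∈₁ , y∉₂) | _ = y , x₂ , x∈p∪q⁺ (inj₁ y∈₁) , x∈p∪q⁺ (inj₂ x₂∈) , other-leg
        where
        other-leg : leg y ≢ leg x₂
        other-leg eq with same-leg y x₂ eq
        ... | inj₁ refl = y∉₂ x₂∈
        ... | inj₂ refl = y∉₂ (closed₂ x₂ x₂∈)
      ... | no _ | yes (y , y∈₂ , y∉₁) = y , x₁ , x∈p∪q⁺ (inj₂ y∈₂) , x∈p∪q⁺ (inj₁ x₁∈) , other-leg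
        where
        other-leg : leg y ≢ leg x₁
        other-leg eq with same-leg y x₁ eq
        ... | inj₁ refl = y∉₁ x₁∈
        ... | inj₂ refl = y∉₁ (closed₁ x₁ x₁∈)
      ... | no C₁⊆C₂ | no C₂⊆C₁ = contradiction (⊆-antisym (λ {x} → included C₁⊆C₂) (λ {x} → included C₂⊆C₁)) C₁≢C₂
        where
        included : ∀ {P Q} → ¬ (∃ λ y → y ∈ P × y ∉ Q) → ∀ {y} → y ∈ P → y ∈ Q
        included {Q = Q} none {y} y∈ = decidable-stable (y ∈? Q) λ y∉ → none (y , y∈ , y∉)

    legCycle : ∀ i → Walk G i i
    legCycle i = step (edge₁ i) (inj₁ (cong (λ z → z , cyc z) (leg-edge₁ i)))
                (step (edge₂ i) (inj₂ (cong (λ z → z , cyc z) (leg-edge₂ i))) [])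

    Leg : Vertex → Subset (N + N)
    Leg i = edgeSet (legCycle i)

    ∈-Leg⁻ : ∀ {i x} → x ∈ Leg i → leg x ≡ i
    ∈-Leg⁻ {i} x∈ with ∈-edgeSet⁻ (legCycle i) x∈
    ... | here refl         = leg-edge₁ i
    ... | there (here refl) = leg-edge₂ i

    ∈-Leg⁺ : ∀ {i x} → leg x ≡ i → x ∈ Leg i
    ∈-Leg⁺ {i} {x} eq with leg≡⇒edge₁⊎edge₂ x i eq
    ... | inj₁ refl = ∈-edgeSet⁺ (legCycle i) (here refl)
    ... | inj₂ refl = ∈-edgeSet⁺ (legCycle i) (there (here refl))

    Leg-cycle : ∀ i → IsCycle G (Leg i)
    Leg-cycle i = i , legCycle i , (s≤s z≤n , (edge₁≢edge₂ i i ∷ []) ∷ [] ∷ [] , (cyc-no-fixpoint i ∷ []) ∷ [] ∷ []) , refl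

    Leg-unbalanced : ∀ i → ¬ B (Leg i)
    Leg-unbalanced i balanced = oneLeg-¬spanning (Leg i) i (λ e → ∈-Leg⁻) (proj₂ (balanced-hamiltonian (Leg i) balanced))

    Leg∪Leg-circuit : ∀ i j → i ≢ j → Circ (Leg i ∪ Leg j)
    Leg∪Leg-circuit i j i≢j =
      inj₂ (inj₂ (Leg i , Leg j , Leg-cycle i , Leg-cycle j , Leg-unbalanced i , Leg-unbalanced j , Leg≢Leg , one-common , refl))
      where
      Leg≢Leg : Leg i ≢ Leg j
      Leg≢Leg eq = i≢j (trans (sym (leg-edge₁ i)) (∈-Leg⁻ (subst (edge₁ i ∈_) eq (∈-Leg⁺ (leg-edge₁ i)))))
      one-common : ∀ x y → VertexOf G x (Leg i) → VertexOf G x (Leg j) → VertexOf G y (Leg i) → VertexOf G y (Leg j) → x ≡ y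
      one-common x y xi xj yi yj =
        meet (vertexOf-oneLeg (λ e → ∈-Leg⁻) xi) (vertexOf-oneLeg (λ e → ∈-Leg⁻) xj)
             (vertexOf-oneLeg (λ e → ∈-Leg⁻) yi) (vertexOf-oneLeg (λ e → ∈-Leg⁻) yj)
        where
        meet : x ≡ i ⊎ x ≡ cyc i → x ≡ j ⊎ x ≡ cyc j → y ≡ i ⊎ y ≡ cyc i → y ≡ j ⊎ y ≡ cyc j → x ≡ y
        meet (inj₁ p₁) _ (inj₁ p₃) _ = trans p₁ (sym p₃)
        meet (inj₂ p₁) _ (inj₂ p₃) _ = trans p₁ (sym p₃)
        meet (inj₁ p₁) (inj₁ p₂) _ _ = contradiction (trans (sym p₁) p₂) i≢j
        meet _ _ (inj₁ p₃) (inj₁ p₄) = contradiction (trans (sym p₃) p₄) i≢j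
        meet (inj₂ p₁) (inj₂ p₂) _ _ = contradiction (cyc-injective (trans (sym p₁) p₂)) i≢j
        meet _ _ (inj₂ p₃) (inj₂ p₄) = contradiction (cyc-injective (trans (sym p₃) p₄)) i≢j
        meet (inj₁ p₁) (inj₂ p₂) (inj₂ p₃) (inj₁ p₄) =
          contradiction (trans (cong cyc (trans (sym p₂) p₁)) (trans (sym p₃) p₄)) (cyc²-no-fixpoint j)
        meet (inj₂ p₁) (inj₁ p₂) (inj₁ p₃) (inj₂ p₄) =
          contradiction (trans (cong cyc (trans (sym p₁) p₂)) (trans (sym p₄) p₃)) (cyc²-no-fixpoint i)

    -- Leg i together with the path cyc i → … → i through the transversal τ of the other legs.
    module LegTheta (i : Vertex) (τ : Vertex → Edge) (leg-τ : ∀ j → leg (τ j) ≡ j) where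

      τ-joins : ∀ y → Joins G (τ y) y (cyc y)
      τ-joins y = inj₁ (cong (λ z → z , cyc z) (leg-τ y))

      τ-path : (m : ℕ) (y : Vertex) → Walk G y (rot m y)
      τ-path zero    y = []
      τ-path (suc m) y = step (τ y) (τ-joins y) (τ-path m (cyc y))

      rot-N≡i : rot N i ≡ i
      rot-N≡i = rot-period i

      P₁ P₂ P₃ : Walk G (cyc i) (rot N i)
      P₁ = step (edge₁ i) (subst (Joins G (edge₁ i) (cyc i)) (sym rot-N≡i) (inj₂ (cong (λ z → z , cyc z) (leg-edge₁ i)))) []
      P₂ = step (edge₂ i) (subst (Joins G (edge₂ i) (cyc i)) (sym rot-N≡i) (inj₂ (cong (λ z → z , cyc z) (leg-edge₂ i)))) []
      P₃ = τ-path (2 + k) (cyc i)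

      verts-τ-path : ∀ m y {z} → z List.∈ verts (τ-path m y) → ∃ λ j → j ≤ m × z ≡ rot j y
      verts-τ-path zero    y (here refl) = 0 , z≤n , refl
      verts-τ-path (suc m) y (here refl) = 0 , z≤n , refl
      verts-τ-path (suc m) y (there z∈) with verts-τ-path m (cyc y) z∈
      ... | j , j≤m , eq = suc j , s≤s j≤m , eq

      τ-path-isPath : ∀ m y → m < N → AllPairs _≢_ (verts (τ-path m y))
      τ-path-isPath zero    y _   = [] ∷ []
      τ-path-isPath (suc m) y m<N = All.tabulate (λ {z} z∈ → y≢z z z∈) ∷ τ-path-isPath m (cyc y) (<-trans (n<1+n m) m<N)
        where
        y≢z : ∀ z → z List.∈ verts (τ-path m (cyc y)) → y ≢ z
        y≢z z z∈ eq with verts-τ-path m (cyc y) z∈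
        ... | j , j≤m , z≡ = rot-no-fixpoint (suc j) y (s≤s z≤n) (≤-<-trans (s≤s j≤m) m<N) (sym (trans eq z≡))

      edges-τ-path⁻ : ∀ m y {x} → x List.∈ edges (τ-path m y) → ∃ λ z → x ≡ τ z
      edges-τ-path⁻ (suc m) y (here refl) = y , refl
      edges-τ-path⁻ (suc m) y (there x∈) = edges-τ-path⁻ m (cyc y) x∈

      edges-τ-path⁺ : ∀ m y j → j < m → τ (rot j y) List.∈ edges (τ-path m y)
      edges-τ-path⁺ (suc m) y zero    _         = here refl
      edges-τ-path⁺ (suc m) y (suc j) (s≤s j<m) = there (edges-τ-path⁺ m (cyc y) j j<m)

      Θ : Subset (N + N)
      Θ = edgeSet P₁ ∪ edgeSet P₂ ∪ edgeSet P₃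

      ends-differ : cyc i ≢ rot N i
      ends-differ eq = cyc-no-fixpoint i (trans eq rot-N≡i)

      P₁≢P₂ : edgeSet P₁ ≢ edgeSet P₂
      P₁≢P₂ eq with ∈-edgeSet⁻ P₂ (subst (edge₁ i ∈_) eq (∈-edgeSet⁺ P₁ (here refl)))
      ... | here eq′ = edge₁≢edge₂ i i eq′

      P₁≢P₃ : edgeSet P₁ ≢ edgeSet P₃
      P₁≢P₃ eq with ∈-edgeSet⁻ P₁ (subst (τ (cyc i) ∈_) (sym eq) (∈-edgeSet⁺ P₃ (here refl)))
      ... | here eq′ = cyc-no-fixpoint i (trans (sym (leg-τ (cyc i))) (trans (cong leg eq′) (leg-edge₁ i)))

      P₂≢P₃ : edgeSet P₂ ≢ edgeSet P₃
      P₂≢P₃ eq with ∈-edgeSet⁻ P₂ (subst (τ (cyc i) ∈_) (sym eq) (∈-edgeSet⁺ P₃ (here refl)))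
      ... | here eq′ = cyc-no-fixpoint i (trans (sym (leg-τ (cyc i))) (trans (cong leg eq′) (leg-edge₂ i)))

      Θ-theta : IsTheta G Θ
      Θ-theta = cyc i , rot N i , ends-differ , P₁ , P₂ , P₃ ,
                (ends-differ ∷ []) ∷ [] ∷ [] , (ends-differ ∷ []) ∷ [] ∷ [] , τ-path-isPath (2 + k) (cyc i) (n<1+n _) ,
                (λ _ ()) , (λ _ ()) , (λ _ ()) , P₁≢P₂ , P₁≢P₃ , P₂≢P₃ , refl

      ∈-Θ-leg : ∀ x → leg x ≡ i → x ∈ Θ
      ∈-Θ-leg x eq with leg≡⇒edge₁⊎edge₂ x i eq
      ... | inj₁ refl = x∈p∪q⁺ (inj₁ (∈-edgeSet⁺ P₁ (here refl)))
      ... | inj₂ refl = x∈p∪q⁺ {p = edgeSet P₁} (inj₂ (x∈p∪q⁺ (inj₁ (∈-edgeSet⁺ P₂ (here refl)))))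

      ∈-Θ⁻ : ∀ x → x ∈ Θ → leg x ≡ i ⊎ x ≡ τ (leg x)
      ∈-Θ⁻ x x∈ with x∈p∪q⁻ (edgeSet P₁) _ x∈
      ... | inj₁ x∈₁ with ∈-edgeSet⁻ P₁ x∈₁
      ...   | here refl = inj₁ (leg-edge₁ i)
      ∈-Θ⁻ x x∈ | inj₂ x∈₂₃ with x∈p∪q⁻ (edgeSet P₂) _ x∈₂₃
      ... | inj₁ x∈₂ with ∈-edgeSet⁻ P₂ x∈₂
      ...   | here refl = inj₁ (leg-edge₂ i)
      ∈-Θ⁻ x x∈ | inj₂ _ | inj₂ x∈₃ with edges-τ-path⁻ (2 + k) (cyc i) (∈-edgeSet⁻ P₃ x∈₃)
      ... | z , refl = inj₂ (cong τ (sym (leg-τ z)))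

      ∈-Θ-τ : ∀ x → x ≡ τ (leg x) → x ∈ Θ
      ∈-Θ-τ x x≡τ with leg x ≟ i
      ... | yes eq = ∈-Θ-leg x eq
      ... | no leg≢i with rot-surjective (cyc i) (leg x)
      ...   | j , j<N , rot≡ = x∈p∪q⁺ {p = edgeSet P₁} (inj₂ (x∈p∪q⁺ {p = edgeSet P₂} (inj₂
                (∈-edgeSet⁺ P₃ (subst (List._∈ edges P₃) (trans (cong τ rot≡) (sym x≡τ)) (edges-τ-path⁺ (2 + k) (cyc i) j j<N-1))))))
        where
        j<N-1 : j < 2 + k
        j<N-1 = ≤∧≢⇒< (≤-pred j<N) λ { refl → leg≢i (trans (sym rot≡) rot-N≡i) }

      Θ-circuit : Circ Θ
      Θ-circuit = inj₂ (inj₁ (Θ-theta , Leg i , Leg-cycle i , Leg-unbalanced i , λ {x} x∈ → ∈-Θ-leg x (∈-Leg⁻ x∈)))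

module SpikeMinor where
  open SubsetFacts
  open import Data.Nat using (ℕ; _+_)
  open import Data.Fin using (Fin; zero; suc; _≟_)
  open import Data.Fin.Subset using (Subset; _∈_; _∉_; _∪_; _─_; Nonempty; ⁅_⁆; ⊤)
  open import Data.Fin.Subset.Properties
    using (x∈⁅x⁆; x∈⁅y⁆⇒x≡y; x∈p∪q⁺; x∈p∪q⁻; x∈p∩q⁺; ∈⊤; ∉⊥; ⊆-antisym; _∈?_; x∈p∧x∉q⇒x∈p─q)
  open import Data.Fin.Properties using (any?)
  open import Data.Product using (Σ; ∃; _×_; _,_; proj₁; proj₂)
  open import Data.Sum using (_⊎_; inj₁; inj₂)
  import Data.Sum as Sum
  open import Data.Empty using (⊥)
  open import Function.Definitions using (Injective)
  open import Relation.Nullary using (¬_; yes; no; Dec; contradiction)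
  open import Relation.Nullary.Decidable using (_×-dec_; ¬?; decidable-stable; True; toWitness)
  open import Relation.Binary.PropositionalEquality

  -- Sealed like Im: unfolding the circuit predicates of the lift matroid slows typechecking down severely.
  opaque
    LiftCircuit : (k : ℕ) → (Subset ((3 + k) + (3 + k)) → Set) → Subset ((3 + k) + (3 + k)) → Set
    LiftCircuit k B = Circuit (Lift (Δ k) B)

    seal-circuit : ∀ {k B C} → Circuit (Lift (Δ k) B) C → LiftCircuit k B C
    seal-circuit c = c

    unseal-circuit : ∀ {k B C} → LiftCircuit k B C → Circuit (Lift (Δ k) B) C
    unseal-circuit c = c

    MinorCircuit : (k : ℕ) → (Subset ((3 + k) + (3 + k)) → Set) → (X Y : Subset ((3 + k) + (3 + k))) → Set
    MinorCircuit k B = ContractCircuit (Lift (Δ k) B)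

    seal-minorCircuit : ∀ {k B X Y} → ContractCircuit (Lift (Δ k) B) X Y → MinorCircuit k B X Y
    seal-minorCircuit c = c

    unseal-minorCircuit : ∀ {k B X Y} → MinorCircuit k B X Y → ContractCircuit (Lift (Δ k) B) X Y
    unseal-minorCircuit c = c

  -- The trace of a circuit C of the spike is C ─ X; IsCircuit Z holds exactly when Im f Z is a minimal
  -- nonempty trace.
  record SpikeMinorOf {n} (IsCircuit : Subset n → Set) : Set₁ where
    field
      k           : ℕ
      B           : Subset ((3 + k) + (3 + k)) → Set
      isSpike     : IsSpikeClass k B
      f           : Fin n → Fin ((3 + k) + (3 + k))
      f-injective : Injective _≡_ _≡_ f
      X           : Subset ((3 + k) + (3 + k))
      f∉X         : ∀ x → f x ∉ X
      circuit⇒    : ∀ Z → IsCircuit Z → MinorCircuit k B X (Im f Z)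
      ⇒circuit    : ∀ Z → MinorCircuit k B X (Im f Z) → IsCircuit Z

  InS⇒SpikeMinorOf : ∀ {n} (M : Matroid n) → InS M → SpikeMinorOf (Circuit M)
  InS⇒SpikeMinorOf M (k , B , isSpike , f , X , f-injective , X∩image≡⊥ , iso) = record
    { k = k ; B = B ; isSpike = isSpike ; f = f ; f-injective = f-injective ; X = X
    ; f∉X = λ x x∈X → ∉⊥ (subst (f x ∈_) X∩image≡⊥ (x∈p∩q⁺ (x∈X , ∈-image⁺ f ⊤ ∈⊤)))
    ; circuit⇒ = λ Z c → seal-minorCircuit (subst (ContractCircuit (Lift (Δ k) B) X) (sym (Im≡image f Z)) (proj₁ (iso Z) c))
    ; ⇒circuit = λ Z c → proj₂ (iso Z) (subst (ContractCircuit (Lift (Δ k) B) X) (Im≡image f Z) (unseal-minorCircuit c))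
    }

  ∈! : ∀ {n} {x : Fin n} {p : Subset n} {x∈? : True (x ∈? p)} → x ∈ p
  ∈! {x∈? = x∈?} = toWitness x∈?

  ∉! : ∀ {n} {x : Fin n} {p : Subset n} {x∉? : True (¬? (x ∈? p))} → x ∉ p
  ∉! {x∉? = x∉?} = toWitness x∉?

  ∈-triple₁ : ∀ {n} (a b c : Fin n) → a ∈ ⁅ a ⁆ ∪ ⁅ b ⁆ ∪ ⁅ c ⁆
  ∈-triple₁ a b c = x∈p∪q⁺ (inj₁ (x∈⁅x⁆ a))

  ∈-triple₂ : ∀ {n} (a b c : Fin n) → b ∈ ⁅ a ⁆ ∪ ⁅ b ⁆ ∪ ⁅ c ⁆
  ∈-triple₂ a b c = x∈p∪q⁺ {p = ⁅ a ⁆} (inj₂ (x∈p∪q⁺ (inj₁ (x∈⁅x⁆ b))))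

  ∈-triple₃ : ∀ {n} (a b c : Fin n) → c ∈ ⁅ a ⁆ ∪ ⁅ b ⁆ ∪ ⁅ c ⁆
  ∈-triple₃ a b c = x∈p∪q⁺ {p = ⁅ a ⁆} (inj₂ (x∈p∪q⁺ {p = ⁅ b ⁆} (inj₂ (x∈⁅x⁆ c))))

  module Properties {n} {IsCircuit : Subset n → Set} (σ : SpikeMinorOf IsCircuit) where

    open SpikeMinorOf σ public
    open DeltaGraph k public
    open DeltaGraph.Lifted k B isSpike public using (Leg; ∈-Leg⁻; ∈-Leg⁺; module LegTheta)

    Circ : Subset (N + N) → Set
    Circ = LiftCircuit k B

    circuit-shape : ∀ C → Circ C → Shape C
    circuit-shape C c = DeltaGraph.Lifted.circuit-shape k B isSpike C (unseal-circuit c)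

    ∈─⁺ : ∀ {C y} → y ∈ C → y ∉ X → y ∈ C ─ X
    ∈─⁺ = x∈p∧x∉q⇒x∈p─q

    ∈─⁻ˡ : ∀ {C y} → y ∈ C ─ X → y ∈ C
    ∈─⁻ˡ y∈ = proj₁ (x∈p─q⇒x∈p×x∉q y∈)

    ∈─⁻ʳ : ∀ {C y} → y ∈ C ─ X → y ∉ X
    ∈─⁻ʳ y∈ = proj₂ (x∈p─q⇒x∈p×x∉q y∈)

    Im-single⁻ : ∀ {a y} → y ∈ Im f ⁅ a ⁆ → y ≡ f a
    Im-single⁻ {a} y∈ with ∈-Im⁻ f ⁅ a ⁆ y∈
    ... | i , i∈ , refl = cong f (x∈⁅y⁆⇒x≡y a i∈)

    Im-pair⁻ : ∀ {a b y} → y ∈ Im f (⁅ a ⁆ ∪ ⁅ b ⁆) → y ≡ f a ⊎ y ≡ f b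
    Im-pair⁻ {a} {b} y∈ with ∈-Im⁻ f (⁅ a ⁆ ∪ ⁅ b ⁆) y∈
    ... | i , i∈ , refl with x∈p∪q⁻ ⁅ a ⁆ _ i∈
    ...   | inj₁ i∈a = inj₁ (cong f (x∈⁅y⁆⇒x≡y a i∈a))
    ...   | inj₂ i∈b = inj₂ (cong f (x∈⁅y⁆⇒x≡y b i∈b))

    Im-triple⁻ : ∀ {a b c y} → y ∈ Im f (⁅ a ⁆ ∪ ⁅ b ⁆ ∪ ⁅ c ⁆) → y ≡ f a ⊎ y ≡ f b ⊎ y ≡ f c
    Im-triple⁻ {a} {b} {c} y∈ with ∈-Im⁻ f (⁅ a ⁆ ∪ ⁅ b ⁆ ∪ ⁅ c ⁆) y∈
    ... | i , i∈ , refl with x∈p∪q⁻ ⁅ a ⁆ _ i∈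
    ...   | inj₁ i∈a = inj₁ (cong f (x∈⁅y⁆⇒x≡y a i∈a))
    ...   | inj₂ i∈bc with x∈p∪q⁻ ⁅ b ⁆ _ i∈bc
    ...     | inj₁ i∈b = inj₂ (inj₁ (cong f (x∈⁅y⁆⇒x≡y b i∈b)))
    ...     | inj₂ i∈c = inj₂ (inj₂ (cong f (x∈⁅y⁆⇒x≡y c i∈c)))

    Im-single⁺ : ∀ a → f a ∈ Im f ⁅ a ⁆
    Im-single⁺ a = ∈-Im⁺ f ⁅ a ⁆ (x∈⁅x⁆ a)

    Im-pair⁺ˡ : ∀ a b → f a ∈ Im f (⁅ a ⁆ ∪ ⁅ b ⁆)
    Im-pair⁺ˡ a b = ∈-Im⁺ f (⁅ a ⁆ ∪ ⁅ b ⁆) (x∈p∪q⁺ (inj₁ (x∈⁅x⁆ a)))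

    Im-pair⁺ʳ : ∀ a b → f b ∈ Im f (⁅ a ⁆ ∪ ⁅ b ⁆)
    Im-pair⁺ʳ a b = ∈-Im⁺ f (⁅ a ⁆ ∪ ⁅ b ⁆) (x∈p∪q⁺ (inj₂ (x∈⁅x⁆ b)))

    Im-triple⁺₁ : ∀ a b c → f a ∈ Im f (⁅ a ⁆ ∪ ⁅ b ⁆ ∪ ⁅ c ⁆)
    Im-triple⁺₁ a b c = ∈-Im⁺ f _ (∈-triple₁ a b c)

    Im-triple⁺₂ : ∀ a b c → f b ∈ Im f (⁅ a ⁆ ∪ ⁅ b ⁆ ∪ ⁅ c ⁆)
    Im-triple⁺₂ a b c = ∈-Im⁺ f _ (∈-triple₂ a b c)

    Im-triple⁺₃ : ∀ a b c → f c ∈ Im f (⁅ a ⁆ ∪ ⁅ b ⁆ ∪ ⁅ c ⁆)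
    Im-triple⁺₃ a b c = ∈-Im⁺ f _ (∈-triple₃ a b c)

    trace-of : ∀ Z → IsCircuit Z → Σ (Subset (N + N)) λ C →
               Circ C × (∀ y → y ∈ C ─ X → y ∈ Im f Z) × (∀ y → y ∈ Im f Z → y ∈ C ─ X)
    trace-of Z c with unseal-minorCircuit (circuit⇒ Z c)
    ... | _ , (C , c′ , eq) , _ = C , seal-circuit c′ , (λ y y∈ → subst (y ∈_) eq y∈) , (λ y y∈ → subst (y ∈_) (sym eq) y∈)

    TraceMinimal : Subset n → Set
    TraceMinimal Z = ∀ C → Circ C → Nonempty (C ─ X) → (∀ y → y ∈ C ─ X → y ∈ Im f Z) → ∀ y → y ∈ Im f Z → y ∈ C ─ X

    trace-minimal : ∀ Z → IsCircuit Z → TraceMinimal Z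
    trace-minimal Z c C c′ ne sub y y∈ with unseal-minorCircuit (circuit⇒ Z c)
    ... | _ , _ , minimal = subst (y ∈_) (sym (minimal C (unseal-circuit c′) ne (λ {w} w∈ → sub w w∈))) y∈

    circuit-of-trace : ∀ Z C → Circ C → (∀ y → y ∈ C ─ X → y ∈ Im f Z) → (∀ y → y ∈ Im f Z → y ∈ C ─ X) →
                       Nonempty (Im f Z) →
                       TraceMinimal Z → IsCircuit Z
    circuit-of-trace Z C c sub sup ne minimal = ⇒circuit Z (seal-minorCircuit
      ( ne
      , (C , unseal-circuit c , ⊆-antisym (λ {y} → sub y) (λ {y} → sup y))
      , λ C′ c′ ne′ sub′ → ⊆-antisym sub′ (λ {y} → minimal C′ (seal-circuit c′) ne′ (λ w → sub′) y)))

    f∈Im⇒∈ : ∀ {Z w} → f w ∈ Im f Z → w ∈ Z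
    f∈Im⇒∈ {Z} fw∈ with ∈-Im⁻ f Z fw∈
    ... | i , i∈ , eq = subst (_∈ Z) (f-injective eq) i∈

    LegsOf : Edge → Edge → Subset (N + N)
    LegsOf e e′ = Leg (leg e) ∪ Leg (leg e′)

    LegsOf-circuit : ∀ e e′ → leg e ≢ leg e′ → Circ (LegsOf e e′)
    LegsOf-circuit e e′ legs≢ = seal-circuit (DeltaGraph.Lifted.Leg∪Leg-circuit k B isSpike (leg e) (leg e′) legs≢)

    ∈-LegsOf⁻ : ∀ {e e′ y} → y ∈ LegsOf e e′ → leg y ≡ leg e ⊎ leg y ≡ leg e′
    ∈-LegsOf⁻ {e} {e′} y∈ with x∈p∪q⁻ (Leg (leg e)) (Leg (leg e′)) y∈
    ... | inj₁ y∈e  = inj₁ (∈-Leg⁻ y∈e)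
    ... | inj₂ y∈e′ = inj₂ (∈-Leg⁻ y∈e′)

    ∈-LegsOf⁺ˡ : ∀ {e e′ y} → leg y ≡ leg e → y ∈ LegsOf e e′
    ∈-LegsOf⁺ˡ eq = x∈p∪q⁺ (inj₁ (∈-Leg⁺ eq))

    ∈-LegsOf⁺ʳ : ∀ {e e′ y} → leg y ≡ leg e′ → y ∈ LegsOf e e′
    ∈-LegsOf⁺ʳ {e} eq = x∈p∪q⁺ {p = Leg (leg e)} (inj₂ (∈-Leg⁺ eq))

    LegsOf⊆legClosed : ∀ {C} → LegClosed C → ∀ {g g′} → g ∈ C → g′ ∈ C → ∀ z → z ∈ LegsOf g g′ → z ∈ C
    LegsOf⊆legClosed closed {g} {g′} g∈ g′∈ z z∈ with ∈-LegsOf⁻ {g} {g′} z∈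
    ... | inj₁ eq = legClosed-same-leg closed g∈ eq
    ... | inj₂ eq = legClosed-same-leg closed g′∈ eq

    SomeLegContracted : Set
    SomeLegContracted = Σ Edge λ e → e ∈ X × partner e ∈ X

    someLegContracted? : Dec SomeLegContracted
    someLegContracted? = any? λ e → (e ∈? X) ×-dec (partner e ∈? X)

    NoLegContracted : Set
    NoLegContracted = ∀ e → e ∉ X ⊎ partner e ∉ X

    ¬some⇒noLegContracted : ¬ SomeLegContracted → NoLegContracted
    ¬some⇒noLegContracted none e with e ∈? X
    ... | no e∉  = inj₁ e∉
    ... | yes e∈ = inj₂ λ p∈ → none (e , e∈ , p∈)

    NonLoop : Fin n → Set
    NonLoop x = ∀ C → Circ C → Nonempty (C ─ X) → ¬ (∀ y → y ∈ C ─ X → y ≡ f x)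

    nonLoop-in-circuit : ∀ Z x z → IsCircuit Z → x ∈ Z → z ∈ Z → z ≢ x → NonLoop x
    nonLoop-in-circuit Z x z c x∈ z∈ z≢x C c′ ne only-x =
      z≢x (f-injective (only-x (f z) (trace-minimal Z c C c′ ne
        (λ y y∈ → subst (_∈ Im f Z) (sym (only-x y y∈)) (∈-Im⁺ f Z x∈)) (f z) (∈-Im⁺ f Z z∈))))

    nonLoop-of-non-circuit : ∀ x → ¬ IsCircuit ⁅ x ⁆ → NonLoop x
    nonLoop-of-non-circuit x ¬circuit C c (y₀ , y₀∈) only-x = ¬circuit (circuit-of-trace ⁅ x ⁆ C c
      (λ y y∈ → subst (_∈ Im f ⁅ x ⁆) (sym (only-x y y∈)) (Im-single⁺ x))
      (λ y y∈ → subst (_∈ C ─ X) (trans (only-x y₀ y₀∈) (sym (Im-single⁻ {x} y∈))) y₀∈)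
      (f x , Im-single⁺ x)
      (λ C′ c′ (y₁ , y₁∈) sub y y∈ → subst (_∈ C′ ─ X) (trans (Im-single⁻ {x} (sub y₁ y₁∈)) (sym (Im-single⁻ {x} y∈))) y₁∈))

    -- Minimality holds because a circuit whose trace is just one of f x, f y would make it a loop.
    circuit-of-pair-trace : ∀ x y → NonLoop x → NonLoop y → ∀ C → Circ C → f x ∈ C ─ X → f y ∈ C ─ X →
                            (∀ z → z ∈ C ─ X → z ≡ f x ⊎ z ≡ f y) → IsCircuit (⁅ x ⁆ ∪ ⁅ y ⁆)
    circuit-of-pair-trace x y nonLoop-x nonLoop-y C c fx∈ fy∈ only-xy =
      circuit-of-trace (⁅ x ⁆ ∪ ⁅ y ⁆) C c (λ z z∈ → Im-pair (only-xy z z∈)) (λ z z∈ → trace-pair (Im-pair⁻ {x} {y} z∈))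
        (f x , Im-pair⁺ˡ x y) minimal
      where
      Im-pair : ∀ {z} → z ≡ f x ⊎ z ≡ f y → z ∈ Im f (⁅ x ⁆ ∪ ⁅ y ⁆)
      Im-pair (inj₁ refl) = Im-pair⁺ˡ x y
      Im-pair (inj₂ refl) = Im-pair⁺ʳ x y
      trace-pair : ∀ {z} → z ≡ f x ⊎ z ≡ f y → z ∈ C ─ X
      trace-pair (inj₁ refl) = fx∈
      trace-pair (inj₂ refl) = fy∈
      minimal : TraceMinimal (⁅ x ⁆ ∪ ⁅ y ⁆)
      minimal C′ c′ ne sub z z∈ with Im-pair⁻ {x} {y} z∈
      ... | inj₁ refl = decidable-stable (f x ∈? C′ ─ X) λ fx∉ →
                          nonLoop-y C′ c′ ne λ w w∈ → only-y fx∉ w∈ (Im-pair⁻ {x} {y} (sub w w∈))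
        where
        only-y : ∀ {w} → f x ∉ C′ ─ X → w ∈ C′ ─ X → w ≡ f x ⊎ w ≡ f y → w ≡ f y
        only-y fx∉ w∈ (inj₁ refl) = contradiction w∈ fx∉
        only-y fx∉ w∈ (inj₂ eq)   = eq
      ... | inj₂ refl = decidable-stable (f y ∈? C′ ─ X) λ fy∉ →
                          nonLoop-x C′ c′ ne λ w w∈ → only-x fy∉ w∈ (Im-pair⁻ {x} {y} (sub w w∈))
        where
        only-x : ∀ {w} → f y ∉ C′ ─ X → w ∈ C′ ─ X → w ≡ f x ⊎ w ≡ f y → w ≡ f x
        only-x fy∉ w∈ (inj₁ eq)   = eq
        only-x fy∉ w∈ (inj₂ refl) = contradiction w∈ fy∉

    PartnerContracted : Fin n → Set
    PartnerContracted x = partner (f x) ∈ X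

    data TraceShape (Z : Subset n) : Set where
      partnerClosed : (∀ x → x ∈ Z → ¬ PartnerContracted x → partner (f x) ∈ Im f Z) → TraceShape Z
      meetsAllPairs : (∀ w → f w ∈ Im f Z ⊎ (¬ PartnerContracted w → partner (f w) ∈ Im f Z)) → TraceShape Z

    trace-shape : ∀ Z → IsCircuit Z → TraceShape Z
    trace-shape Z c with trace-of Z c
    ... | C , c′ , sub , sup with circuit-shape C c′
    ...   | unionOfLegs closed _ = partnerClosed λ x x∈ p∉ → sub _ (∈─⁺ (closed _ (∈─⁻ˡ (sup (f x) (∈-Im⁺ f Z x∈)))) p∉)
    ...   | meetsAllLegs meets =
            meetsAllPairs λ w → Sum.map (λ fw∈ → sub _ (∈─⁺ fw∈ (f∉X w))) (λ p∈ p∉ → sub _ (∈─⁺ p∈ p∉)) (meets (f w))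

    partnerContracted⇒legs≢ : ∀ x y → x ≢ y → PartnerContracted x → leg (f x) ≢ leg (f y)
    partnerContracted⇒legs≢ x y x≢y px eq with same-leg (f y) (f x) (sym eq)
    ... | inj₁ fy≡fx = x≢y (f-injective (sym fy≡fx))
    ... | inj₂ fy≡p  = f∉X y (subst (_∈ X) (sym fy≡p) px)

    trace-LegsOf⊆ : ∀ x y → PartnerContracted x → PartnerContracted y →
                    ∀ z → z ∈ LegsOf (f x) (f y) ─ X → z ≡ f x ⊎ z ≡ f y
    trace-LegsOf⊆ x y px py z z∈ with ∈-LegsOf⁻ {f x} {f y} (∈─⁻ˡ z∈)
    ... | inj₁ eq with same-leg z (f x) eq
    ...   | inj₁ z≡ = inj₁ z≡
    ...   | inj₂ z≡ = contradiction (subst (_∈ X) (sym z≡) px) (∈─⁻ʳ z∈)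
    trace-LegsOf⊆ x y px py z z∈ | inj₂ eq with same-leg z (f y) eq
    ...   | inj₁ z≡ = inj₂ z≡
    ...   | inj₂ z≡ = contradiction (subst (_∈ X) (sym z≡) py) (∈─⁻ʳ z∈)

    f∈trace-LegsOfˡ : ∀ x y → f x ∈ LegsOf (f x) (f y) ─ X
    f∈trace-LegsOfˡ x y = ∈─⁺ (∈-LegsOf⁺ˡ {f x} {f y} refl) (f∉X x)

    f∈trace-LegsOfʳ : ∀ x y → f y ∈ LegsOf (f x) (f y) ─ X
    f∈trace-LegsOfʳ x y = ∈─⁺ (∈-LegsOf⁺ʳ {f x} {f y} refl) (f∉X y)

    -- The legs of f x and f y form a circuit with trace {f x, f y}.
    partnersContracted⇒parallel : ∀ x y → x ≢ y → NonLoop x → NonLoop y →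
                                  PartnerContracted x → PartnerContracted y → IsCircuit (⁅ x ⁆ ∪ ⁅ y ⁆)
    partnersContracted⇒parallel x y x≢y nonLoop-x nonLoop-y px py =
      circuit-of-pair-trace x y nonLoop-x nonLoop-y (LegsOf (f x) (f y)) (LegsOf-circuit (f x) (f y) (partnerContracted⇒legs≢ x y x≢y px))
        (f∈trace-LegsOfˡ x y) (f∈trace-LegsOfʳ x y) (trace-LegsOf⊆ x y px py)

    partnersContracted⇒¬together : ∀ Z → IsCircuit Z → ∀ x y z → x ∈ Z → y ∈ Z → z ∈ Z → x ≢ y → z ≢ x → z ≢ y →
                                   PartnerContracted x → ¬ PartnerContracted y
    partnersContracted⇒¬together Z c x y z x∈ y∈ z∈ x≢y z≢x z≢y px py with
      trace-LegsOf⊆ x y px py (f z) (trace-minimal Z c (LegsOf (f x) (f y))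
        (LegsOf-circuit (f x) (f y) (partnerContracted⇒legs≢ x y x≢y px)) (f x , f∈trace-LegsOfˡ x y)
        (λ w w∈ → Im-xy (trace-LegsOf⊆ x y px py w w∈)) (f z) (∈-Im⁺ f Z z∈))
      where
      Im-xy : ∀ {w} → w ≡ f x ⊎ w ≡ f y → w ∈ Im f Z
      Im-xy (inj₁ refl) = ∈-Im⁺ f Z x∈
      Im-xy (inj₂ refl) = ∈-Im⁺ f Z y∈
    ... | inj₁ eq = z≢x (f-injective eq)
    ... | inj₂ eq = z≢y (f-injective eq)

    ¬three-on-one-leg : ∀ ℓ x y → x ≢ ℓ → y ≢ ℓ → x ≢ y → leg (f x) ≡ leg (f ℓ) → leg (f y) ≢ leg (f ℓ)
    ¬three-on-one-leg ℓ x y x≢ℓ y≢ℓ x≢y x-on y-on with same-leg (f x) (f ℓ) x-on | same-leg (f y) (f ℓ) y-on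
    ... | inj₁ eq | _       = x≢ℓ (f-injective eq)
    ... | _       | inj₁ eq = y≢ℓ (f-injective eq)
    ... | inj₂ p  | inj₂ q  = x≢y (f-injective (trans p (sym q)))

    pigeonhole₃ : ∀ {A : Set} {a b c g₁ g₂ : A} → a ≡ g₁ ⊎ a ≡ g₂ → b ≡ g₁ ⊎ b ≡ g₂ → c ≡ g₁ ⊎ c ≡ g₂ →
                  a ≡ b ⊎ a ≡ c ⊎ b ≡ c
    pigeonhole₃ (inj₁ p) (inj₁ q) _ = inj₁ (trans p (sym q))
    pigeonhole₃ (inj₂ p) (inj₂ q) _ = inj₁ (trans p (sym q))
    pigeonhole₃ (inj₁ p) _ (inj₁ q) = inj₂ (inj₁ (trans p (sym q)))
    pigeonhole₃ (inj₂ p) _ (inj₂ q) = inj₂ (inj₁ (trans p (sym q)))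
    pigeonhole₃ _ (inj₁ p) (inj₁ q) = inj₂ (inj₂ (trans p (sym q)))
    pigeonhole₃ _ (inj₂ p) (inj₂ q) = inj₂ (inj₂ (trans p (sym q)))

    module ContractedLeg (e₀ : Edge) (e₀∈X : e₀ ∈ X) (p₀∈X : partner e₀ ∈ X) where

      leg≢contracted : ∀ x → leg (f x) ≢ leg e₀
      leg≢contracted x eq with same-leg (f x) e₀ eq
      ... | inj₁ fx≡ = f∉X x (subst (_∈ X) (sym fx≡) e₀∈X)
      ... | inj₂ fx≡ = f∉X x (subst (_∈ X) (sym fx≡) p₀∈X)

      with-contracted-circuit : ∀ x → Circ (LegsOf e₀ (f x))
      with-contracted-circuit x = LegsOf-circuit e₀ (f x) (λ eq → leg≢contracted x (sym eq))

      trace-with-contracted⁻ : ∀ x z → z ∈ LegsOf e₀ (f x) ─ X → z ≡ f x ⊎ z ≡ partner (f x)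
      trace-with-contracted⁻ x z z∈ with ∈-LegsOf⁻ {e₀} {f x} (∈─⁻ˡ z∈)
      ... | inj₂ eq = same-leg z (f x) eq
      ... | inj₁ eq with same-leg z e₀ eq
      ...   | inj₁ z≡ = contradiction (subst (_∈ X) (sym z≡) e₀∈X) (∈─⁻ʳ z∈)
      ...   | inj₂ z≡ = contradiction (subst (_∈ X) (sym z≡) p₀∈X) (∈─⁻ʳ z∈)

      f∈trace-with-contracted : ∀ x → f x ∈ LegsOf e₀ (f x) ─ X
      f∈trace-with-contracted x = ∈─⁺ (∈-LegsOf⁺ʳ {e₀} {f x} refl) (f∉X x)

      partner∈trace-with-contracted : ∀ x → ¬ PartnerContracted x → partner (f x) ∈ LegsOf e₀ (f x) ─ X
      partner∈trace-with-contracted x p∉ = ∈─⁺ (∈-LegsOf⁺ʳ {e₀} {f x} (leg-partner (f x))) p∉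

      nonLoop⇒partner∉X : ∀ x → NonLoop x → ¬ PartnerContracted x
      nonLoop⇒partner∉X x nonLoop px = nonLoop (LegsOf e₀ (f x)) (with-contracted-circuit x) (f x , f∈trace-with-contracted x)
        λ z z∈ → only-fx z∈ (trace-with-contracted⁻ x z z∈)
        where
        only-fx : ∀ {z} → z ∈ LegsOf e₀ (f x) ─ X → z ≡ f x ⊎ z ≡ partner (f x) → z ≡ f x
        only-fx z∈ (inj₁ eq) = eq
        only-fx z∈ (inj₂ eq) = contradiction (subst (_∈ X) (sym eq) px) (∈─⁻ʳ z∈)

      partner≢-in-circuit : ∀ Z → IsCircuit Z → ∀ x y z → x ∈ Z → y ∈ Z → z ∈ Z → z ≢ x → z ≢ y → partner (f x) ≢ f y
      partner≢-in-circuit Z c x y z x∈ y∈ z∈ z≢x z≢y eq with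
        trace-with-contracted⁻ x (f z) (trace-minimal Z c (LegsOf e₀ (f x)) (with-contracted-circuit x)
          (f x , f∈trace-with-contracted x) (λ w w∈ → Im-xy (trace-with-contracted⁻ x w w∈)) (f z) (∈-Im⁺ f Z z∈))
        where
        Im-xy : ∀ {w} → w ≡ f x ⊎ w ≡ partner (f x) → w ∈ Im f Z
        Im-xy (inj₁ refl) = ∈-Im⁺ f Z x∈
        Im-xy (inj₂ refl) = subst (_∈ Im f Z) (sym eq) (∈-Im⁺ f Z y∈)
      ... | inj₁ fz≡ = z≢x (f-injective fz≡)
      ... | inj₂ fz≡ = z≢y (f-injective (trans fz≡ eq))

      ¬U₂₄ : ∀ a b c d → b ≢ a → a ≢ c → b ≢ c → a ≢ d → b ≢ d → c ≢ d →
             IsCircuit (⁅ a ⁆ ∪ ⁅ b ⁆ ∪ ⁅ c ⁆) → IsCircuit (⁅ a ⁆ ∪ ⁅ b ⁆ ∪ ⁅ d ⁆) →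
             IsCircuit (⁅ a ⁆ ∪ ⁅ c ⁆ ∪ ⁅ d ⁆) → ⊥
      ¬U₂₄ a b c d b≢a a≢c b≢c a≢d b≢d c≢d abc abd acd = by-trace (trace-shape _ abc)
        where
        nonLoop-a = nonLoop-in-circuit _ a b abc (∈-triple₁ a b c) (∈-triple₂ a b c) b≢a
        nonLoop-d = nonLoop-in-circuit _ d a abd (∈-triple₃ a b d) (∈-triple₁ a b d) a≢d
        by-trace : TraceShape (⁅ a ⁆ ∪ ⁅ b ⁆ ∪ ⁅ c ⁆) → ⊥
        by-trace (partnerClosed closed) with Im-triple⁻ {a} {b} {c} (closed a (∈-triple₁ a b c) (nonLoop⇒partner∉X a nonLoop-a))
        ... | inj₁ eq        = partner-≢ (f a) eq
        ... | inj₂ (inj₁ eq) = partner≢-in-circuit _ abc a b c (∈-triple₁ a b c) (∈-triple₂ a b c) (∈-triple₃ a b c)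
                                 (≢-sym a≢c) (≢-sym b≢c) eq
        ... | inj₂ (inj₂ eq) = partner≢-in-circuit _ abc a c b (∈-triple₁ a b c) (∈-triple₃ a b c) (∈-triple₂ a b c) b≢a b≢c eq
        by-trace (meetsAllPairs meets) with meets d
        ... | inj₁ fd∈ with Im-triple⁻ {a} {b} {c} fd∈
        ...   | inj₁ eq        = a≢d (sym (f-injective eq))
        ...   | inj₂ (inj₁ eq) = b≢d (sym (f-injective eq))
        ...   | inj₂ (inj₂ eq) = c≢d (sym (f-injective eq))
        by-trace (meetsAllPairs meets) | inj₂ pd∈ with Im-triple⁻ {a} {b} {c} (pd∈ (nonLoop⇒partner∉X d nonLoop-d))
        ...   | inj₁ eq        = partner≢-in-circuit _ abd d a b (∈-triple₃ a b d) (∈-triple₁ a b d) (∈-triple₂ a b d) b≢d b≢a eq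
        ...   | inj₂ (inj₁ eq) = partner≢-in-circuit _ abd d b a (∈-triple₃ a b d) (∈-triple₂ a b d) (∈-triple₁ a b d) a≢d (≢-sym b≢a) eq
        ...   | inj₂ (inj₂ eq) = partner≢-in-circuit _ acd d c a (∈-triple₃ a c d) (∈-triple₂ a c d) (∈-triple₁ a c d) a≢d a≢c eq

      partner≡⇒parallel : ∀ x y → NonLoop x → NonLoop y → partner (f x) ≡ f y → IsCircuit (⁅ x ⁆ ∪ ⁅ y ⁆)
      partner≡⇒parallel x y nonLoop-x nonLoop-y eq =
        circuit-of-pair-trace x y nonLoop-x nonLoop-y (LegsOf e₀ (f x)) (with-contracted-circuit x) (f∈trace-with-contracted x)
          (subst (_∈ LegsOf e₀ (f x) ─ X) eq (partner∈trace-with-contracted x λ px → f∉X y (subst (_∈ X) eq px)))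
          λ z z∈ → Sum.map₂ (λ z≡ → trans z≡ eq) (trace-with-contracted⁻ x z z∈)

    module NoContractedLeg (none : NoLegContracted) where

      uncontracted-on-leg : ∀ e → Σ Edge λ h → leg h ≡ leg e × h ∉ X × (h ≡ e ⊎ h ≡ partner e)
      uncontracted-on-leg e with none e
      ... | inj₁ e∉ = e , refl , e∉ , inj₁ refl
      ... | inj₂ p∉ = partner e , leg-partner e , p∉ , inj₂ refl

      legs-of-trace : ∀ {C S} → LegClosed C → (∀ y → y ∈ C ─ X → y ∈ S) → ∀ {g} → g ∈ C → ∃ λ h → leg h ≡ leg g × h ∈ S
      legs-of-trace closed sub {g} g∈ with uncontracted-on-leg g
      ... | h , leg-h , h∉ , h≡ = h , leg-h , sub h (∈─⁺ (legClosed-∋ closed g∈ h≡) h∉)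

      -- As no leg lies in X, a union of legs leaves an element of each leg in its trace; so a circuit with trace
      -- {f ℓ} meets every leg.
      loop⇒legs-contracted : ∀ ℓ → IsCircuit ⁅ ℓ ⁆ → ∀ e → leg e ≢ leg (f ℓ) → e ∈ X ⊎ partner e ∈ X
      loop⇒legs-contracted ℓ c e off-ℓ with trace-of ⁅ ℓ ⁆ c
      ... | C , c′ , sub , _ with circuit-shape C c′
      ...   | unionOfLegs closed (g , g′ , g∈ , g′∈ , legs≢) with legs-of-trace closed sub g∈ | legs-of-trace closed sub g′∈
      ...     | h , leg-h , h∈ | h′ , leg-h′ , h′∈ =
                contradiction (trans (sym leg-h) (trans (cong leg (trans (Im-single⁻ {ℓ} h∈) (sym (Im-single⁻ {ℓ} h′∈)))) leg-h′)) legs≢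
      loop⇒legs-contracted ℓ c e off-ℓ | C , c′ , sub , _ | meetsAllLegs meets with e ∈? X | partner e ∈? X
      ... | yes e∈ | _      = inj₁ e∈
      ... | no _   | yes p∈ = inj₂ p∈
      ... | no e∉  | no p∉ with meets e
      ...   | inj₁ e∈C = contradiction (cong leg (Im-single⁻ {ℓ} (sub e (∈─⁺ e∈C e∉)))) off-ℓ
      ...   | inj₂ p∈C = contradiction (trans (sym (leg-partner e)) (cong leg (Im-single⁻ {ℓ} (sub (partner e) (∈─⁺ p∈C p∉))))) off-ℓ

      unionOfLegs-trace-on-legs : ∀ Z → IsCircuit Z → ∀ C → (∀ y → y ∈ C ─ X → y ∈ Im f Z) → LegClosed C →
                                  ∀ g g′ → g ∈ C → g′ ∈ C → leg g ≢ leg g′ →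
                                  ∀ y → y ∈ Im f Z → leg y ≡ leg g ⊎ leg y ≡ leg g′
      unionOfLegs-trace-on-legs Z c C sub closed g g′ g∈ g′∈ legs≢ y y∈ =
        ∈-LegsOf⁻ {g} {g′} (∈─⁻ˡ (trace-minimal Z c (LegsOf g g′) (LegsOf-circuit g g′ legs≢) nonempty
          (λ z z∈ → sub z (∈─⁺ (LegsOf⊆legClosed closed g∈ g′∈ z (∈─⁻ˡ z∈)) (∈─⁻ʳ z∈))) y y∈))
        where
        nonempty : Nonempty (LegsOf g g′ ─ X)
        nonempty with uncontracted-on-leg g
        ... | h , leg-h , h∉ , _ = h , ∈─⁺ (∈-LegsOf⁺ˡ {g} {g′} leg-h) h∉

      -- Minimality: a circuit meeting every leg would put an element of w's leg into the trace, and a union of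
      -- legs with trace inside Im f Z must consist of the legs of e₁ and e₂.
      circuit-of-LegsOf-trace : ∀ e₁ e₂ → leg e₁ ≢ leg e₂ →
                                ∀ w → w ∉ X → partner w ∉ X → leg w ≢ leg e₁ → leg w ≢ leg e₂ →
                                ∀ Z → (∀ y → y ∈ LegsOf e₁ e₂ ─ X → y ∈ Im f Z) → (∀ y → y ∈ Im f Z → y ∈ LegsOf e₁ e₂ ─ X) →
                                Nonempty (Im f Z) → IsCircuit Z
      circuit-of-LegsOf-trace e₁ e₂ legs≢ w w∉ pw∉ w≢₁ w≢₂ Z sub sup ne =
        circuit-of-trace Z (LegsOf e₁ e₂) (LegsOf-circuit e₁ e₂ legs≢) sub sup ne minimal
        where
        on-legs : ∀ {z} → z ∈ Im f Z → leg z ≡ leg e₁ ⊎ leg z ≡ leg e₂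
        on-legs z∈ = ∈-LegsOf⁻ {e₁} {e₂} (∈─⁻ˡ (sup _ z∈))
        off-w : ∀ {z} → leg z ≡ leg w → z ∉ Im f Z
        off-w eq z∈ with on-legs z∈
        ... | inj₁ eq′ = w≢₁ (trans (sym eq) eq′)
        ... | inj₂ eq′ = w≢₂ (trans (sym eq) eq′)
        minimal : TraceMinimal Z
        minimal C′ c′ _ sub′ y y∈ with circuit-shape C′ c′
        ... | meetsAllLegs meets with meets w
        ...   | inj₁ w∈ = contradiction (sub′ w (∈─⁺ w∈ w∉)) (off-w refl)
        ...   | inj₂ p∈ = contradiction (sub′ (partner w) (∈─⁺ p∈ pw∉)) (off-w (leg-partner w))
        minimal C′ c′ _ sub′ y y∈ | unionOfLegs closed (g , g′ , g∈ , g′∈ , legs≢′) =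
          ∈─⁺ (y∈C′ (on-legs y∈)) (∈─⁻ʳ (sup y y∈))
          where
          leg-in : ∀ {g} → g ∈ C′ → leg g ≡ leg e₁ ⊎ leg g ≡ leg e₂
          leg-in g∈ with legs-of-trace closed sub′ g∈
          ... | h , leg-h , h∈ = Sum.map (trans (sym leg-h)) (trans (sym leg-h)) (on-legs h∈)
          y∈C′ : leg y ≡ leg e₁ ⊎ leg y ≡ leg e₂ → y ∈ C′
          y∈C′ leg-y with leg-in g∈ | leg-in g′∈ | leg-y
          ... | inj₁ p | inj₁ q | _      = contradiction (trans p (sym q)) legs≢′
          ... | inj₂ p | inj₂ q | _      = contradiction (trans p (sym q)) legs≢′
          ... | inj₁ p | inj₂ q | inj₁ r = legClosed-same-leg closed g∈ (trans r (sym p))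
          ... | inj₁ p | inj₂ q | inj₂ r = legClosed-same-leg closed g′∈ (trans r (sym q))
          ... | inj₂ p | inj₁ q | inj₁ r = legClosed-same-leg closed g′∈ (trans r (sym q))
          ... | inj₂ p | inj₁ q | inj₂ r = legClosed-same-leg closed g∈ (trans r (sym p))

      triangle-of-legs : ∀ a b c d → PartnerContracted a → partner (f b) ≡ f c → ¬ PartnerContracted d →
                         a ≢ b → a ≢ d → b ≢ d → c ≢ d → IsCircuit (⁅ a ⁆ ∪ ⁅ b ⁆ ∪ ⁅ c ⁆)
      triangle-of-legs a b c d pa pb≡fc pd∉ a≢b a≢d b≢d c≢d =
        circuit-of-LegsOf-trace (f a) (f b) (partnerContracted⇒legs≢ a b a≢b pa) (f d) (f∉X d) pd∉ d≢a d≢b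
          (⁅ a ⁆ ∪ ⁅ b ⁆ ∪ ⁅ c ⁆) sub sup (f a , Im-triple⁺₁ a b c)
        where
        d≢a : leg (f d) ≢ leg (f a)
        d≢a eq with same-leg (f d) (f a) eq
        ... | inj₁ fd≡ = a≢d (sym (f-injective fd≡))
        ... | inj₂ fd≡ = f∉X d (subst (_∈ X) (sym fd≡) pa)
        d≢b : leg (f d) ≢ leg (f b)
        d≢b eq with same-leg (f d) (f b) eq
        ... | inj₁ fd≡ = b≢d (sym (f-injective fd≡))
        ... | inj₂ fd≡ = c≢d (sym (f-injective (trans fd≡ pb≡fc)))
        sub : ∀ y → y ∈ LegsOf (f a) (f b) ─ X → y ∈ Im f (⁅ a ⁆ ∪ ⁅ b ⁆ ∪ ⁅ c ⁆)
        sub y y∈ with ∈-LegsOf⁻ {f a} {f b} (∈─⁻ˡ y∈)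
        ... | inj₁ eq with same-leg y (f a) eq
        ...   | inj₁ refl = Im-triple⁺₁ a b c
        ...   | inj₂ refl = contradiction pa (∈─⁻ʳ y∈)
        sub y y∈ | inj₂ eq with same-leg y (f b) eq
        ...   | inj₁ refl = Im-triple⁺₂ a b c
        ...   | inj₂ refl = subst (_∈ Im f (⁅ a ⁆ ∪ ⁅ b ⁆ ∪ ⁅ c ⁆)) (sym pb≡fc) (Im-triple⁺₃ a b c)
        sup : ∀ y → y ∈ Im f (⁅ a ⁆ ∪ ⁅ b ⁆ ∪ ⁅ c ⁆) → y ∈ LegsOf (f a) (f b) ─ X
        sup y y∈ with Im-triple⁻ {a} {b} {c} y∈
        ... | inj₁ refl        = ∈─⁺ (∈-LegsOf⁺ˡ {f a} {f b} refl) (f∉X a)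
        ... | inj₂ (inj₁ refl) = ∈─⁺ (∈-LegsOf⁺ʳ {f a} {f b} refl) (f∉X b)
        ... | inj₂ (inj₂ refl) = ∈─⁺ (∈-LegsOf⁺ʳ {f a} {f b} (trans (cong leg (sym pb≡fc)) (leg-partner (f b)))) (f∉X c)

      unionOfLegs-pair-trace⇒partnerContracted : ∀ x y C → (∀ z → z ∈ C ─ X → z ∈ Im f (⁅ x ⁆ ∪ ⁅ y ⁆)) → f x ∈ C →
                                                 LegClosed C → TwoLegs C → PartnerContracted x
      unionOfLegs-pair-trace⇒partnerContracted x y C sub fx∈ closed (g , g′ , g∈ , g′∈ , legs≢) =
        decidable-stable (partner (f x) ∈? X) λ p∉ → partner-in-trace (Im-pair⁻ {x} {y} (sub _ (∈─⁺ (closed _ fx∈) p∉)))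
        where
        leg-of : ∀ {g} → g ∈ C → partner (f x) ≡ f y → leg g ≡ leg (f x)
        leg-of g∈ eq with legs-of-trace closed sub g∈
        ... | h , leg-h , h∈ with Im-pair⁻ {x} {y} h∈
        ...   | inj₁ refl = sym leg-h
        ...   | inj₂ refl = trans (sym leg-h) (trans (cong leg (sym eq)) (leg-partner (f x)))
        partner-in-trace : ¬ (partner (f x) ≡ f x ⊎ partner (f x) ≡ f y)
        partner-in-trace (inj₁ eq) = partner-≢ (f x) eq
        partner-in-trace (inj₂ eq) = legs≢ (trans (leg-of g∈ eq) (sym (leg-of g′∈ eq)))

      PartnersAmong : Fin n → Fin n → Set
      PartnersAmong x y = ∀ z → z ≢ x → z ≢ y → ¬ PartnerContracted z → partner (f z) ≡ f x ⊎ partner (f z) ≡ f y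

      pair-trace : ∀ x y → IsCircuit (⁅ x ⁆ ∪ ⁅ y ⁆) → PartnerContracted x ⊎ PartnersAmong x y
      pair-trace x y c with trace-of _ c
      ... | C , c′ , sub , sup with circuit-shape C c′
      ...   | unionOfLegs closed twoLegs =
              inj₁ (unionOfLegs-pair-trace⇒partnerContracted x y C sub (∈─⁻ˡ (sup (f x) (Im-pair⁺ˡ x y))) closed twoLegs)
      ...   | meetsAllLegs meets = inj₂ partner-in
        where
        partner-in : PartnersAmong x y
        partner-in z z≢x z≢y pz∉X with meets (f z)
        ... | inj₂ p∈ = Im-pair⁻ {x} {y} (sub _ (∈─⁺ p∈ pz∉X))
        ... | inj₁ fz∈ with Im-pair⁻ {x} {y} (sub _ (∈─⁺ fz∈ (f∉X z)))
        ...   | inj₁ eq = contradiction (f-injective eq) z≢x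
        ...   | inj₂ eq = contradiction (f-injective eq) z≢y

      loop⇒partnerContracted : ∀ ℓ → IsCircuit ⁅ ℓ ⁆ → ∀ x → leg (f x) ≢ leg (f ℓ) → PartnerContracted x
      loop⇒partnerContracted ℓ c x off-ℓ with loop⇒legs-contracted ℓ c (f x) off-ℓ
      ... | inj₁ fx∈ = contradiction fx∈ (f∉X x)
      ... | inj₂ p∈  = p∈

      -- The theta of the leg of f y and a transversal through f x and contracted edges elsewhere has trace {f x, f y}.
      loop-leg-parallel : ∀ ℓ x y → IsCircuit ⁅ ℓ ⁆ → NonLoop x → NonLoop y →
                          leg (f x) ≡ leg (f ℓ) → leg (f y) ≢ leg (f ℓ) → IsCircuit (⁅ x ⁆ ∪ ⁅ y ⁆)
      loop-leg-parallel ℓ x y loop nonLoop-x nonLoop-y x-on y-off =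
        circuit-of-pair-trace x y nonLoop-x nonLoop-y Θ (seal-circuit Θ-circuit) fx∈ fy∈ only-xy
        where
        τ : Vertex → Edge
        τ j with j ≟ leg (f ℓ)
        ... | yes _ = f x
        ... | no _ with edge₁ j ∈? X
        ...   | yes _ = edge₁ j
        ...   | no _  = edge₂ j
        leg-τ : ∀ j → leg (τ j) ≡ j
        leg-τ j with j ≟ leg (f ℓ)
        ... | yes eq = trans x-on (sym eq)
        ... | no _ with edge₁ j ∈? X
        ...   | yes _ = leg-edge₁ j
        ...   | no _  = leg-edge₂ j
        τ-on : ∀ j → j ≡ leg (f ℓ) → τ j ≡ f x
        τ-on j eq with j ≟ leg (f ℓ)
        ... | yes _  = refl
        ... | no j≢ = contradiction eq j≢
        τ-off : ∀ j → j ≢ leg (f ℓ) → τ j ∈ X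
        τ-off j j≢ with j ≟ leg (f ℓ)
        ... | yes eq = contradiction eq j≢
        ... | no _ with edge₁ j ∈? X
        ...   | yes e∈ = e∈
        ...   | no e∉ with loop⇒legs-contracted ℓ loop (edge₁ j) (λ eq → j≢ (trans (sym (leg-edge₁ j)) eq))
        ...     | inj₁ e∈ = contradiction e∈ e∉
        ...     | inj₂ p∈ = subst (_∈ X) (partner-edge₁ j) p∈
        open LegTheta (leg (f y)) τ leg-τ
        fx∈ : f x ∈ Θ ─ X
        fx∈ = ∈─⁺ (∈-Θ-τ (f x) (sym (τ-on (leg (f x)) x-on))) (f∉X x)
        fy∈ : f y ∈ Θ ─ X
        fy∈ = ∈─⁺ (∈-Θ-leg (f y) refl) (f∉X y)
        only-xy : ∀ z → z ∈ Θ ─ X → z ≡ f x ⊎ z ≡ f y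
        only-xy z z∈ with ∈-Θ⁻ z (∈─⁻ˡ z∈)
        ... | inj₁ eq with same-leg z (f y) eq
        ...   | inj₁ z≡ = inj₂ z≡
        ...   | inj₂ z≡ = contradiction (subst (_∈ X) (sym z≡) (loop⇒partnerContracted ℓ loop y y-off)) (∈─⁻ʳ z∈)
        only-xy z z∈ | inj₂ z≡τ = on-or-off (leg z ≟ leg (f ℓ))
          where
          on-or-off : Dec (leg z ≡ leg (f ℓ)) → z ≡ f x ⊎ z ≡ f y
          on-or-off (yes eq) = inj₁ (trans z≡τ (τ-on (leg z) eq))
          on-or-off (no z≢)  = contradiction (subst (_∈ X) (sym z≡τ) (τ-off (leg z) z≢)) (∈─⁻ʳ z∈)

  pattern i0 = zero
  pattern i1 = suc zero
  pattern i2 = suc (suc zero)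
  pattern i3 = suc (suc (suc zero))
  pattern i4 = suc (suc (suc (suc zero)))
  pattern i5 = suc (suc (suc (suc (suc zero))))

module Item-i where
  open SpikeMinor
  open import Data.Fin using (_≟_)
  open import Data.Fin.Subset using (_∈_; _∪_; ⁅_⁆; inside; outside)
  open import Data.Fin.Subset.Properties using (x∈p∪q⁺; x∈⁅x⁆)
  open import Data.Vec using ([]; _∷_; there)
  open import Data.Product using (_,_)
  open import Data.Sum using (inj₁; inj₂)
  open import Data.Empty using (⊥; ⊥-elim)
  open import Relation.Nullary using (¬_; Dec; yes; no; contradiction)
  open import Relation.Binary.PropositionalEquality

  M₁ : Matroid 5
  M₁ = U 0 1 ⊕ U 1 1 ⊕ U 1 3

  coloop₁ : ∀ {Z} → i1 ∈ Z → ¬ Circuit M₁ Z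
  coloop₁ (there ()) (inj₁ (_ ∷ [] , _ , refl))
  coloop₁ _          (inj₂ (_ , inj₁ (inside ∷ [] , () , refl) , refl))
  coloop₁ _          (inj₂ (_ , inj₁ (outside ∷ [] , () , refl) , refl))
  coloop₁ (there ()) (inj₂ (_ , inj₂ (_ , _ , refl) , refl))

  ¬spikeMinor : SpikeMinorOf (Circuit M₁) → ⊥
  ¬spikeMinor σ = by-cases someLegContracted?
    where
    open Properties σ
    loop₀ : Circuit M₁ ⁅ i0 ⁆
    loop₀ = inj₁ (inside ∷ [] , refl , refl)
    parallel₂₃ : Circuit M₁ (⁅ i2 ⁆ ∪ ⁅ i3 ⁆)
    parallel₂₃ = inj₂ (_ , inj₂ (_ , refl , refl) , refl)
    parallel₂₄ : Circuit M₁ (⁅ i2 ⁆ ∪ ⁅ i4 ⁆)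
    parallel₂₄ = inj₂ (_ , inj₂ (_ , refl , refl) , refl)
    nonLoop₁ = nonLoop-of-non-circuit i1 (coloop₁ ∈!)
    nonLoop₂ = nonLoop-in-circuit _ i2 i3 parallel₂₃ ∈! ∈! (λ ())
    nonLoop₃ = nonLoop-in-circuit _ i3 i2 parallel₂₃ ∈! ∈! (λ ())
    nonLoop₄ = nonLoop-in-circuit _ i4 i2 parallel₂₄ ∈! ∈! (λ ())

    by-cases : Dec SomeLegContracted → ⊥
    by-cases (yes (e₀ , e₀∈X , p₀∈X)) = contradiction (f-injective (trans (sym partner₂≡f₃) partner₂≡f₄)) λ ()
      where
      open ContractedLeg e₀ e₀∈X p₀∈X
      partner-of-parallel : ∀ x y → x ≢ i1 → y ≢ i1 → NonLoop x → NonLoop y → Circuit M₁ (⁅ x ⁆ ∪ ⁅ y ⁆) →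
                            partner (f x) ≡ f y
      partner-of-parallel x y x≢1 y≢1 nonLoop-x nonLoop-y parallel with trace-shape _ parallel
      ... | partnerClosed closed with Im-pair⁻ {x} {y} (closed x (x∈p∪q⁺ (inj₁ (x∈⁅x⁆ x))) (nonLoop⇒partner∉X x nonLoop-x))
      ...   | inj₁ eq = contradiction eq (partner-≢ (f x))
      ...   | inj₂ eq = eq
      partner-of-parallel x y x≢1 y≢1 nonLoop-x nonLoop-y parallel | meetsAllPairs meets with meets i1
      ...   | inj₁ f₁∈ with Im-pair⁻ {x} {y} f₁∈
      ...     | inj₁ eq = contradiction (sym (f-injective eq)) x≢1
      ...     | inj₂ eq = contradiction (sym (f-injective eq)) y≢1
      partner-of-parallel x y x≢1 y≢1 nonLoop-x nonLoop-y parallel | meetsAllPairs meets | inj₂ p₁∈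
        with Im-pair⁻ {x} {y} (p₁∈ (nonLoop⇒partner∉X i1 nonLoop₁))
      ...     | inj₁ eq = ⊥-elim (coloop₁ (x∈p∪q⁺ (inj₁ (x∈⁅x⁆ i1))) (partner≡⇒parallel i1 x nonLoop₁ nonLoop-x eq))
      ...     | inj₂ eq = ⊥-elim (coloop₁ (x∈p∪q⁺ (inj₁ (x∈⁅x⁆ i1))) (partner≡⇒parallel i1 y nonLoop₁ nonLoop-y eq))
      partner₂≡f₃ = partner-of-parallel i2 i3 (λ ()) (λ ()) nonLoop₂ nonLoop₃ parallel₂₃
      partner₂≡f₄ = partner-of-parallel i2 i4 (λ ()) (λ ()) nonLoop₂ nonLoop₄ parallel₂₄
    by-cases (no none) = by-legs
      where
      open NoContractedLeg (¬some⇒noLegContracted none)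
      contracted = loop⇒partnerContracted i0 loop₀
      by-legs : ⊥
      by-legs with leg (f i1) ≟ leg (f i0) | leg (f i2) ≟ leg (f i0) | leg (f i3) ≟ leg (f i0)
      ... | no off₁ | no off₂ | _       =
        coloop₁ ∈! (partnersContracted⇒parallel i1 i2 (λ ()) nonLoop₁ nonLoop₂ (contracted i1 off₁) (contracted i2 off₂))
      ... | no off₁ | yes _   | no off₃ =
        coloop₁ ∈! (partnersContracted⇒parallel i1 i3 (λ ()) nonLoop₁ nonLoop₃ (contracted i1 off₁) (contracted i3 off₃))
      ... | no _    | yes on₂ | yes on₃ = ¬three-on-one-leg i0 i2 i3 (λ ()) (λ ()) (λ ()) on₂ on₃
      ... | yes on₁ | yes on₂ | _       = ¬three-on-one-leg i0 i1 i2 (λ ()) (λ ()) (λ ()) on₁ on₂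
      ... | yes on₁ | no off₂ | _       = coloop₁ ∈! (loop-leg-parallel i0 i1 i2 loop₀ nonLoop₁ nonLoop₂ on₁ off₂)

  U₀₁⊕U₁₁⊕U₁₃∉𝒮 : ¬ InS M₁
  U₀₁⊕U₁₁⊕U₁₃∉𝒮 h = ¬spikeMinor (InS⇒SpikeMinorOf M₁ h)

module Item-ii where
  open SpikeMinor
  open import Data.Fin using (_≟_)
  open import Data.Fin.Subset using (_∈_; _∪_; ⁅_⁆; inside; outside)
  open import Data.Vec using ([]; _∷_; there)
  open import Data.Product using (_,_)
  open import Data.Sum using (inj₁; inj₂)
  open import Data.Empty using (⊥)
  open import Relation.Nullary using (¬_; Dec; yes; no; contradiction)
  open import Relation.Binary.PropositionalEquality

  M₂ : Matroid 5
  M₂ = U 0 1 ⊕ U 1 1 ⊕ U 2 3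

  coloop₁ : ∀ {Z} → i1 ∈ Z → ¬ Circuit M₂ Z
  coloop₁ (there ()) (inj₁ (_ ∷ [] , _ , refl))
  coloop₁ _          (inj₂ (_ , inj₁ (inside ∷ [] , () , refl) , refl))
  coloop₁ _          (inj₂ (_ , inj₁ (outside ∷ [] , () , refl) , refl))
  coloop₁ (there ()) (inj₂ (_ , inj₂ (_ , _ , refl) , refl))

  ¬spikeMinor : SpikeMinorOf (Circuit M₂) → ⊥
  ¬spikeMinor σ = by-cases someLegContracted?
    where
    open Properties σ
    loop₀ : Circuit M₂ ⁅ i0 ⁆
    loop₀ = inj₁ (inside ∷ [] , refl , refl)
    triangle₂₃₄ : Circuit M₂ (⁅ i2 ⁆ ∪ ⁅ i3 ⁆ ∪ ⁅ i4 ⁆)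
    triangle₂₃₄ = inj₂ (_ , inj₂ (_ , refl , refl) , refl)
    nonLoop₁ = nonLoop-of-non-circuit i1 (coloop₁ ∈!)
    nonLoop₂ = nonLoop-in-circuit _ i2 i3 triangle₂₃₄ ∈! ∈! (λ ())
    nonLoop₃ = nonLoop-in-circuit _ i3 i2 triangle₂₃₄ ∈! ∈! (λ ())
    nonLoop₄ = nonLoop-in-circuit _ i4 i2 triangle₂₃₄ ∈! ∈! (λ ())

    by-cases : Dec SomeLegContracted → ⊥
    by-cases (yes (e₀ , e₀∈X , p₀∈X)) = by-trace (trace-shape _ triangle₂₃₄)
      where
      open ContractedLeg e₀ e₀∈X p₀∈X
      by-trace : TraceShape (⁅ i2 ⁆ ∪ ⁅ i3 ⁆ ∪ ⁅ i4 ⁆) → ⊥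
      by-trace (partnerClosed closed) with Im-triple⁻ {i2} {i3} {i4} (closed i2 ∈! (nonLoop⇒partner∉X i2 nonLoop₂))
      ... | inj₁ eq        = partner-≢ (f i2) eq
      ... | inj₂ (inj₁ eq) = partner≢-in-circuit _ triangle₂₃₄ i2 i3 i4 ∈! ∈! ∈! (λ ()) (λ ()) eq
      ... | inj₂ (inj₂ eq) = partner≢-in-circuit _ triangle₂₃₄ i2 i4 i3 ∈! ∈! ∈! (λ ()) (λ ()) eq
      by-trace (meetsAllPairs meets) with meets i1
      ... | inj₁ f₁∈ = contradiction (f∈Im⇒∈ f₁∈) ∉!
      ... | inj₂ p₁∈ with Im-triple⁻ {i2} {i3} {i4} (p₁∈ (nonLoop⇒partner∉X i1 nonLoop₁))
      ...   | inj₁ eq        = coloop₁ ∈! (partner≡⇒parallel i1 i2 nonLoop₁ nonLoop₂ eq)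
      ...   | inj₂ (inj₁ eq) = coloop₁ ∈! (partner≡⇒parallel i1 i3 nonLoop₁ nonLoop₃ eq)
      ...   | inj₂ (inj₂ eq) = coloop₁ ∈! (partner≡⇒parallel i1 i4 nonLoop₁ nonLoop₄ eq)
    by-cases (no none) = by-legs
      where
      open NoContractedLeg (¬some⇒noLegContracted none)
      contracted = loop⇒partnerContracted i0 loop₀
      by-legs : ⊥
      by-legs with leg (f i1) ≟ leg (f i0) | leg (f i2) ≟ leg (f i0) | leg (f i3) ≟ leg (f i0)
      ... | no off₁ | no off₂ | _       =
        coloop₁ ∈! (partnersContracted⇒parallel i1 i2 (λ ()) nonLoop₁ nonLoop₂ (contracted i1 off₁) (contracted i2 off₂))
      ... | no off₁ | yes _   | no off₃ =
        coloop₁ ∈! (partnersContracted⇒parallel i1 i3 (λ ()) nonLoop₁ nonLoop₃ (contracted i1 off₁) (contracted i3 off₃))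
      ... | no _    | yes on₂ | yes on₃ = ¬three-on-one-leg i0 i2 i3 (λ ()) (λ ()) (λ ()) on₂ on₃
      ... | yes on₁ | yes on₂ | _       = ¬three-on-one-leg i0 i1 i2 (λ ()) (λ ()) (λ ()) on₁ on₂
      ... | yes on₁ | no _    | yes on₃ = ¬three-on-one-leg i0 i1 i3 (λ ()) (λ ()) (λ ()) on₁ on₃
      ... | yes _   | no off₂ | no off₃ =
        partnersContracted⇒¬together _ triangle₂₃₄ i2 i3 i4 ∈! ∈! ∈! (λ ()) (λ ()) (λ ())
          (contracted i2 off₂) (contracted i3 off₃)

  U₀₁⊕U₁₁⊕U₂₃∉𝒮 : ¬ InS M₂
  U₀₁⊕U₁₁⊕U₂₃∉𝒮 h = ¬spikeMinor (InS⇒SpikeMinorOf M₂ h)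

module Item-iii where
  open SpikeMinor
  open import Data.Fin using (_≟_)
  open import Data.Fin.Subset using (_∪_; ⁅_⁆; inside)
  open import Data.Vec using ([]; _∷_)
  open import Data.Product using (_,_)
  open import Data.Sum using (inj₁; inj₂)
  open import Data.Empty using (⊥)
  open import Relation.Nullary using (¬_; Dec; yes; no)
  open import Relation.Binary.PropositionalEquality

  M₃ : Matroid 5
  M₃ = U 0 1 ⊕ U 2 4

  ¬spikeMinor : SpikeMinorOf (Circuit M₃) → ⊥
  ¬spikeMinor σ = by-cases someLegContracted?
    where
    open Properties σ
    loop₀ : Circuit M₃ ⁅ i0 ⁆
    loop₀ = inj₁ (inside ∷ [] , refl , refl)
    triangle₁₂₃ : Circuit M₃ (⁅ i1 ⁆ ∪ ⁅ i2 ⁆ ∪ ⁅ i3 ⁆)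
    triangle₁₂₃ = inj₂ (_ , refl , refl)
    triangle₁₂₄ : Circuit M₃ (⁅ i1 ⁆ ∪ ⁅ i2 ⁆ ∪ ⁅ i4 ⁆)
    triangle₁₂₄ = inj₂ (_ , refl , refl)
    triangle₁₃₄ : Circuit M₃ (⁅ i1 ⁆ ∪ ⁅ i3 ⁆ ∪ ⁅ i4 ⁆)
    triangle₁₃₄ = inj₂ (_ , refl , refl)

    by-cases : Dec SomeLegContracted → ⊥
    by-cases (yes (e₀ , e₀∈X , p₀∈X)) =
      ¬U₂₄ i1 i2 i3 i4 (λ ()) (λ ()) (λ ()) (λ ()) (λ ()) (λ ()) triangle₁₂₃ triangle₁₂₄ triangle₁₃₄
      where open ContractedLeg e₀ e₀∈X p₀∈X
    by-cases (no none) = by-legs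
      where
      open NoContractedLeg (¬some⇒noLegContracted none)
      contracted = loop⇒partnerContracted i0 loop₀
      together = partnersContracted⇒¬together _ triangle₁₂₃
      by-legs : ⊥
      by-legs with leg (f i1) ≟ leg (f i0) | leg (f i2) ≟ leg (f i0) | leg (f i3) ≟ leg (f i0)
      ... | yes on₁ | yes on₂ | _       = ¬three-on-one-leg i0 i1 i2 (λ ()) (λ ()) (λ ()) on₁ on₂
      ... | yes on₁ | _       | yes on₃ = ¬three-on-one-leg i0 i1 i3 (λ ()) (λ ()) (λ ()) on₁ on₃
      ... | _       | yes on₂ | yes on₃ = ¬three-on-one-leg i0 i2 i3 (λ ()) (λ ()) (λ ()) on₂ on₃
      ... | no off₁ | no off₂ | _       = together i1 i2 i3 ∈! ∈! ∈! (λ ()) (λ ()) (λ ()) (contracted i1 off₁) (contracted i2 off₂)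
      ... | yes _   | no off₂ | no off₃ = together i2 i3 i1 ∈! ∈! ∈! (λ ()) (λ ()) (λ ()) (contracted i2 off₂) (contracted i3 off₃)
      ... | no off₁ | yes _   | no off₃ = together i1 i3 i2 ∈! ∈! ∈! (λ ()) (λ ()) (λ ()) (contracted i1 off₁) (contracted i3 off₃)

  U₀₁⊕U₂₄∉𝒮 : ¬ InS M₃
  U₀₁⊕U₂₄∉𝒮 h = ¬spikeMinor (InS⇒SpikeMinorOf M₃ h)

module Item-iv where
  open SpikeMinor
  open SubsetFacts using (Im)
  open import Data.Fin using (Fin; _≟_)
  open import Data.Fin.Subset using (_∈_; _∪_; ⁅_⁆; inside; outside)
  open import Data.Fin.Subset.Properties using (x∈p∪q⁺; x∈⁅x⁆; _∈?_)
  open import Data.Vec using ([]; _∷_)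
  open import Data.Product using (_,_)
  open import Data.Sum using (_⊎_; inj₁; inj₂)
  import Data.Sum as Sum
  open import Data.Empty using (⊥)
  open import Relation.Nullary using (¬_; Dec; yes; no; contradiction)
  open import Relation.Nullary.Decidable using (decidable-stable)
  open import Relation.Binary.PropositionalEquality

  M₄ : Matroid 5
  M₄ = U 1 1 ⊕ U 2 4

  pattern triangle = inj₂ (_ , refl , refl)

  coloop₀ : ∀ {Z} → i0 ∈ Z → ¬ Circuit M₄ Z
  coloop₀ _  (inj₁ (inside ∷ [] , () , refl))
  coloop₀ _  (inj₁ (outside ∷ [] , () , refl))
  coloop₀ () (inj₂ (_ , _ , refl))

  ¬spikeMinor : SpikeMinorOf (Circuit M₄) → ⊥
  ¬spikeMinor σ = by-cases someLegContracted?
    where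
    open Properties σ
    nonLoop₀ = nonLoop-of-non-circuit i0 (coloop₀ ∈!)
    nonLoop₁ = nonLoop-in-circuit (⁅ i1 ⁆ ∪ ⁅ i2 ⁆ ∪ ⁅ i3 ⁆) i1 i2 triangle ∈! ∈! (λ ())
    nonLoop₂ = nonLoop-in-circuit (⁅ i1 ⁆ ∪ ⁅ i2 ⁆ ∪ ⁅ i3 ⁆) i2 i1 triangle ∈! ∈! (λ ())
    nonLoop₃ = nonLoop-in-circuit (⁅ i1 ⁆ ∪ ⁅ i2 ⁆ ∪ ⁅ i3 ⁆) i3 i1 triangle ∈! ∈! (λ ())
    nonLoop₄ = nonLoop-in-circuit (⁅ i1 ⁆ ∪ ⁅ i2 ⁆ ∪ ⁅ i4 ⁆) i4 i1 triangle ∈! ∈! (λ ())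

    by-cases : Dec SomeLegContracted → ⊥
    by-cases (yes (e₀ , e₀∈X , p₀∈X)) = ¬U₂₄ i1 i2 i3 i4 (λ ()) (λ ()) (λ ()) (λ ()) (λ ()) (λ ()) triangle triangle triangle
      where open ContractedLeg e₀ e₀∈X p₀∈X
    by-cases (no none) = by-pairs
      where
      open NoContractedLeg (¬some⇒noLegContracted none)

      module Paired (a b c d : Fin 5) (a≢b : a ≢ b) (a≢c : a ≢ c) (a≢d : a ≢ d) (b≢c : b ≢ c) (b≢d : b ≢ d) (c≢d : c ≢ d)
                    (0≢a : i0 ≢ a) (0≢b : i0 ≢ b) (0≢c : i0 ≢ c) (0≢d : i0 ≢ d) (pa≡fb : partner (f a) ≡ f b)
                    (acd : Circuit M₄ (⁅ a ⁆ ∪ ⁅ c ⁆ ∪ ⁅ d ⁆)) (abc : Circuit M₄ (⁅ a ⁆ ∪ ⁅ b ⁆ ∪ ⁅ c ⁆))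
                    (nonLoop-c : NonLoop c) (nonLoop-d : NonLoop d) where
        pa∉X : ¬ PartnerContracted a
        pa∉X pa∈X = f∉X b (subst (_∈ X) pa≡fb pa∈X)
        fb≡pa : partner (f b) ≡ f a
        fb≡pa = partner-sym pa≡fb
        meets-acd : ∀ w → f w ∈ Im f (⁅ a ⁆ ∪ ⁅ c ⁆ ∪ ⁅ d ⁆) ⊎ (¬ PartnerContracted w → partner (f w) ∈ Im f _)
        meets-acd with trace-shape _ acd
        ... | meetsAllPairs meets = meets
        ... | partnerClosed closed with Im-triple⁻ {a} {c} {d} (subst (_∈ Im f _) pa≡fb (closed a (∈-triple₁ a c d) pa∉X))
        ...   | inj₁ eq        = contradiction (sym (f-injective eq)) a≢b
        ...   | inj₂ (inj₁ eq) = contradiction (f-injective eq) b≢c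
        ...   | inj₂ (inj₂ eq) = contradiction (f-injective eq) b≢d
        partner₀ : ¬ PartnerContracted i0 → partner (f i0) ≡ f a ⊎ partner (f i0) ≡ f c ⊎ partner (f i0) ≡ f d
        partner₀ p₀∉X with meets-acd i0
        ... | inj₂ p₀∈ = Im-triple⁻ {a} {c} {d} (p₀∈ p₀∉X)
        ... | inj₁ f₀∈ with Im-triple⁻ {a} {c} {d} f₀∈
        ...   | inj₁ eq        = contradiction (f-injective eq) 0≢a
        ...   | inj₂ (inj₁ eq) = contradiction (f-injective eq) 0≢c
        ...   | inj₂ (inj₂ eq) = contradiction (f-injective eq) 0≢d
        partner₀≢fa : partner (f i0) ≢ f a
        partner₀≢fa eq = 0≢b (f-injective (trans (sym (partner-sym eq)) pa≡fb))
        one-contracted : ∀ x y → PartnerContracted x → ¬ PartnerContracted y → x ≢ y → a ≢ x → a ≢ y → i0 ≢ x → i0 ≢ y →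
                         (¬ PartnerContracted i0 → partner (f i0) ≡ f a ⊎ partner (f i0) ≡ f x ⊎ partner (f i0) ≡ f y) →
                         NonLoop x → ⊥
        one-contracted x y px py∉X x≢y a≢x a≢y 0≢x 0≢y partner₀-in nonLoop-x with partner (f i0) ∈? X
        ... | yes p₀∈X = coloop₀ (x∈p∪q⁺ (inj₁ (x∈⁅x⁆ i0))) (partnersContracted⇒parallel i0 x 0≢x nonLoop₀ nonLoop-x p₀∈X px)
        ... | no p₀∉X with partner₀-in p₀∉X
        ...   | inj₁ eq        = partner₀≢fa eq
        ...   | inj₂ (inj₁ eq) = f∉X i0 (subst (_∈ X) (partner-sym eq) px)
        ...   | inj₂ (inj₂ eq) = coloop₀ (∈-triple₂ x i0 y)
                                   (triangle-of-legs x i0 y a px eq pa∉X (≢-sym 0≢x) (≢-sym a≢x) 0≢a (≢-sym a≢y))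
        c-partner : PartnerContracted c ⊎ (¬ PartnerContracted d → partner (f d) ≡ f c)
        c-partner with trace-shape _ abc
        ... | partnerClosed closed = inj₁ (decidable-stable (partner (f c) ∈? X) λ pc∉X →
                                       partner-not-in (Im-triple⁻ {a} {b} {c} (closed c (∈-triple₃ a b c) pc∉X)))
          where
          partner-not-in : ¬ (partner (f c) ≡ f a ⊎ partner (f c) ≡ f b ⊎ partner (f c) ≡ f c)
          partner-not-in (inj₁ eq)        = b≢c (f-injective (trans (sym pa≡fb) (partner-sym eq)))
          partner-not-in (inj₂ (inj₁ eq)) = a≢c (f-injective (trans (sym fb≡pa) (partner-sym eq)))
          partner-not-in (inj₂ (inj₂ eq)) = partner-≢ (f c) eq
        ... | meetsAllPairs meets = inj₂ λ pd∉X → partner-of-d pd∉X (meets d)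
          where
          partner-of-d : ¬ PartnerContracted d → f d ∈ Im f (⁅ a ⁆ ∪ ⁅ b ⁆ ∪ ⁅ c ⁆) ⊎ (¬ PartnerContracted d → partner (f d) ∈ Im f _) →
                         partner (f d) ≡ f c
          partner-of-d pd∉X (inj₁ fd∈) with Im-triple⁻ {a} {b} {c} fd∈
          ... | inj₁ eq        = contradiction (sym (f-injective eq)) a≢d
          ... | inj₂ (inj₁ eq) = contradiction (sym (f-injective eq)) b≢d
          ... | inj₂ (inj₂ eq) = contradiction (sym (f-injective eq)) c≢d
          partner-of-d pd∉X (inj₂ pd∈) with Im-triple⁻ {a} {b} {c} (pd∈ pd∉X)
          ... | inj₁ eq        = contradiction (f-injective (trans (sym (partner-sym eq)) pa≡fb)) (≢-sym b≢d)
          ... | inj₂ (inj₁ eq) = contradiction (f-injective (trans (sym (partner-sym eq)) fb≡pa)) (≢-sym a≢d)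
          ... | inj₂ (inj₂ eq) = eq
        neither-contracted : ¬ PartnerContracted c → partner (f d) ≡ f c → ⊥
        neither-contracted pc∉X pd≡fc with partner (f i0) ∈? X
        ... | yes p₀∈X = coloop₀ (∈-triple₁ i0 a b)
                           (triangle-of-legs i0 a b c p₀∈X pa≡fb pc∉X 0≢a 0≢c a≢c b≢c)
        ... | no p₀∉X with partner₀ p₀∉X
        ...   | inj₁ eq        = partner₀≢fa eq
        ...   | inj₂ (inj₁ eq) = 0≢d (f-injective (trans (sym (partner-sym eq)) (partner-sym pd≡fc)))
        ...   | inj₂ (inj₂ eq) = 0≢c (f-injective (trans (sym (partner-sym eq)) pd≡fc))
        impossible : ⊥
        impossible with partner (f c) ∈? X | partner (f d) ∈? X
        ... | yes pc | yes pd = partnersContracted⇒¬together _ acd c d a (∈-triple₂ a c d) (∈-triple₃ a c d) (∈-triple₁ a c d)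
                                  c≢d a≢c a≢d pc pd
        ... | yes pc | no pd∉ = one-contracted c d pc pd∉ c≢d a≢c a≢d 0≢c 0≢d partner₀ nonLoop-c
        ... | no pc∉ | yes pd = one-contracted d c pd pc∉ (≢-sym c≢d) a≢d a≢c 0≢d 0≢c
                                  (λ p₀∉X → Sum.map₂ Sum.swap (partner₀ p₀∉X)) nonLoop-d
        ... | no pc∉ | no pd∉ with c-partner
        ...   | inj₁ pc = pc∉ pc
        ...   | inj₂ pd≡ = neither-contracted pc∉ (pd≡ pd∉)

      NoPartners : Set
      NoPartners = ∀ x y → x ≢ i0 → y ≢ i0 → partner (f x) ≢ f y

      different-legs : NoPartners → ∀ x y → x ≢ y → x ≢ i0 → y ≢ i0 → leg (f x) ≢ leg (f y)
      different-legs no-partners x y x≢y x≢0 y≢0 eq with same-leg (f x) (f y) eq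
      ... | inj₁ fx≡ = x≢y (f-injective fx≡)
      ... | inj₂ fx≡ = no-partners y x y≢0 x≢0 (sym fx≡)

      -- No two of f 1, …, f 4 are partners: a triangle avoiding m is then neither a union of two legs
      -- (two of its elements would share a leg) nor meets the leg of f m.
      unpaired : NoPartners →
                 ∀ m a b c → ¬ PartnerContracted m → Circuit M₄ (⁅ a ⁆ ∪ ⁅ b ⁆ ∪ ⁅ c ⁆) →
                 m ≢ a → m ≢ b → m ≢ c → a ≢ b → a ≢ c → b ≢ c → m ≢ i0 → a ≢ i0 → b ≢ i0 → c ≢ i0 → ⊥
      unpaired no-partners m a b c pm∉X abc m≢a m≢b m≢c a≢b a≢c b≢c m≢0 a≢0 b≢0 c≢0 with trace-of _ abc
      ... | C , c′ , sub , _ with circuit-shape C c′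
      ...   | unionOfLegs closed (g , g′ , g∈ , g′∈ , legs≢) with
              pigeonhole₃ (on-legs (f a) (Im-triple⁺₁ a b c)) (on-legs (f b) (Im-triple⁺₂ a b c)) (on-legs (f c) (Im-triple⁺₃ a b c))
        where on-legs = unionOfLegs-trace-on-legs _ abc C sub closed g g′ g∈ g′∈ legs≢
      ...     | inj₁ same        = different-legs no-partners a b a≢b a≢0 b≢0 same
      ...     | inj₂ (inj₁ same) = different-legs no-partners a c a≢c a≢0 c≢0 same
      ...     | inj₂ (inj₂ same) = different-legs no-partners b c b≢c b≢0 c≢0 same
      unpaired no-partners m a b c pm∉X abc m≢a m≢b m≢c a≢b a≢c b≢c m≢0 a≢0 b≢0 c≢0 | C , c′ , sub , _ | meetsAllLegs meets
        with meets (f m)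
      ...   | inj₁ fm∈ with Im-triple⁻ {a} {b} {c} (sub _ (∈─⁺ fm∈ (f∉X m)))
      ...     | inj₁ eq        = m≢a (f-injective eq)
      ...     | inj₂ (inj₁ eq) = m≢b (f-injective eq)
      ...     | inj₂ (inj₂ eq) = m≢c (f-injective eq)
      unpaired no-partners m a b c pm∉X abc m≢a m≢b m≢c a≢b a≢c b≢c m≢0 a≢0 b≢0 c≢0 | C , c′ , sub , _ | meetsAllLegs meets
        | inj₂ pm∈ with Im-triple⁻ {a} {b} {c} (sub _ (∈─⁺ pm∈ pm∉X))
      ...     | inj₁ eq        = no-partners m a m≢0 a≢0 eq
      ...     | inj₂ (inj₁ eq) = no-partners m b m≢0 b≢0 eq
      ...     | inj₂ (inj₂ eq) = no-partners m c m≢0 c≢0 eq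

      no-pairs : NoPartners → ⊥
      no-pairs no-partners with partner (f i1) ∈? X | partner (f i2) ∈? X
      ... | yes p₁ | yes p₂ =
        partnersContracted⇒¬together (⁅ i1 ⁆ ∪ ⁅ i2 ⁆ ∪ ⁅ i3 ⁆) triangle i1 i2 i3 ∈! ∈! ∈! (λ ()) (λ ()) (λ ()) p₁ p₂
      ... | yes _  | no p₂∉ =
        unpaired no-partners i2 i1 i3 i4 p₂∉ triangle (λ ()) (λ ()) (λ ()) (λ ()) (λ ()) (λ ()) (λ ()) (λ ()) (λ ()) (λ ())
      ... | no p₁∉ | _      =
        unpaired no-partners i1 i2 i3 i4 p₁∉ triangle (λ ()) (λ ()) (λ ()) (λ ()) (λ ()) (λ ()) (λ ()) (λ ()) (λ ()) (λ ())

      by-pairs : ⊥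
      by-pairs with partner (f i1) ≟ f i2 | partner (f i1) ≟ f i3 | partner (f i1) ≟ f i4
                  | partner (f i2) ≟ f i3 | partner (f i2) ≟ f i4 | partner (f i3) ≟ f i4
      ... | yes eq | _      | _      | _      | _      | _      =
        Paired.impossible i1 i2 i3 i4 (λ ()) (λ ()) (λ ()) (λ ()) (λ ()) (λ ()) (λ ()) (λ ()) (λ ()) (λ ()) eq triangle triangle nonLoop₃ nonLoop₄
      ... | no _   | yes eq | _      | _      | _      | _      =
        Paired.impossible i1 i3 i2 i4 (λ ()) (λ ()) (λ ()) (λ ()) (λ ()) (λ ()) (λ ()) (λ ()) (λ ()) (λ ()) eq triangle triangle nonLoop₂ nonLoop₄
      ... | no _   | no _   | yes eq | _      | _      | _      =
        Paired.impossible i1 i4 i2 i3 (λ ()) (λ ()) (λ ()) (λ ()) (λ ()) (λ ()) (λ ()) (λ ()) (λ ()) (λ ()) eq triangle triangle nonLoop₂ nonLoop₃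
      ... | no _   | no _   | no _   | yes eq | _      | _      =
        Paired.impossible i2 i3 i1 i4 (λ ()) (λ ()) (λ ()) (λ ()) (λ ()) (λ ()) (λ ()) (λ ()) (λ ()) (λ ()) eq triangle triangle nonLoop₁ nonLoop₄
      ... | no _   | no _   | no _   | no _   | yes eq | _      =
        Paired.impossible i2 i4 i1 i3 (λ ()) (λ ()) (λ ()) (λ ()) (λ ()) (λ ()) (λ ()) (λ ()) (λ ()) (λ ()) eq triangle triangle nonLoop₁ nonLoop₃
      ... | no _   | no _   | no _   | no _   | no _   | yes eq =
        Paired.impossible i3 i4 i1 i2 (λ ()) (λ ()) (λ ()) (λ ()) (λ ()) (λ ()) (λ ()) (λ ()) (λ ()) (λ ()) eq triangle triangle nonLoop₁ nonLoop₂
      ... | no n₁₂ | no n₁₃ | no n₁₄ | no n₂₃ | no n₂₄ | no n₃₄ = no-pairs no-partners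
        where
        no-partners : NoPartners
        no-partners i0 _  0≢0 _   _  = 0≢0 refl
        no-partners _  i0 _   0≢0 _  = 0≢0 refl
        no-partners i1 i1 _   _   eq = partner-≢ _ eq
        no-partners i2 i2 _   _   eq = partner-≢ _ eq
        no-partners i3 i3 _   _   eq = partner-≢ _ eq
        no-partners i4 i4 _   _   eq = partner-≢ _ eq
        no-partners i1 i2 _   _   eq = n₁₂ eq
        no-partners i1 i3 _   _   eq = n₁₃ eq
        no-partners i1 i4 _   _   eq = n₁₄ eq
        no-partners i2 i3 _   _   eq = n₂₃ eq
        no-partners i2 i4 _   _   eq = n₂₄ eq
        no-partners i3 i4 _   _   eq = n₃₄ eq
        no-partners i2 i1 _   _   eq = n₁₂ (partner-sym eq)
        no-partners i3 i1 _   _   eq = n₁₃ (partner-sym eq)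
        no-partners i4 i1 _   _   eq = n₁₄ (partner-sym eq)
        no-partners i3 i2 _   _   eq = n₂₃ (partner-sym eq)
        no-partners i4 i2 _   _   eq = n₂₄ (partner-sym eq)
        no-partners i4 i3 _   _   eq = n₃₄ (partner-sym eq)

  U₁₁⊕U₂₄∉𝒮 : ¬ InS M₄
  U₁₁⊕U₂₄∉𝒮 h = ¬spikeMinor (InS⇒SpikeMinorOf M₄ h)

module Item-v where
  open SpikeMinor
  open SubsetFacts using (Im)
  open import Data.Nat using (s≤s; z≤n)
  open import Data.Fin.Subset using (_∈_; _∪_; ⁅_⁆; inside)
  open import Data.Fin.Subset.Properties using (_∈?_)
  open import Data.Vec using ([]; _∷_; there)
  open import Data.List.Relation.Unary.All using ([]; _∷_)
  open import Data.List.Relation.Unary.AllPairs using ([]; _∷_)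
  open import Data.Product using (_,_)
  open import Data.Sum using (_⊎_; inj₁; inj₂)
  open import Data.Empty using (⊥)
  open import Relation.Nullary using (¬_; Dec; yes; no; contradiction)
  open import Relation.Binary.PropositionalEquality

  M₅ : Matroid 6
  M₅ = U 1 2 ⊕ CycleMatroid H

  digon : Walk H i0 i0
  digon = step i0 (inj₁ refl) (step i3 (inj₂ refl) [])

  triangle₀₁₂ : Walk H i0 i0
  triangle₀₁₂ = step i0 (inj₁ refl) (step i1 (inj₁ refl) (step i2 (inj₁ refl) []))

  parallel₀₁ : Circuit M₅ (⁅ i0 ⁆ ∪ ⁅ i1 ⁆)
  parallel₀₁ = inj₁ (inside ∷ inside ∷ [] , refl , refl)

  parallel₂₅ : Circuit M₅ (⁅ i2 ⁆ ∪ ⁅ i5 ⁆)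
  parallel₂₅ = inj₂ (_ , (i0 , digon , (s≤s z≤n , ((λ ()) ∷ []) ∷ [] ∷ [] , ((λ ()) ∷ []) ∷ [] ∷ []) , refl) , refl)

  triangle₂₃₄ : Circuit M₅ (⁅ i2 ⁆ ∪ ⁅ i3 ⁆ ∪ ⁅ i4 ⁆)
  triangle₂₃₄ = inj₂ (_ , (i0 , triangle₀₁₂ , (s≤s z≤n , ((λ ()) ∷ (λ ()) ∷ []) ∷ ((λ ()) ∷ []) ∷ [] ∷ [] ,
                                                           ((λ ()) ∷ (λ ()) ∷ []) ∷ ((λ ()) ∷ []) ∷ [] ∷ []) , refl) , refl)

  straddling : ∀ {Z} → i0 ∈ Z ⊎ i1 ∈ Z → i2 ∈ Z ⊎ i3 ∈ Z ⊎ i4 ∈ Z ⊎ i5 ∈ Z → ¬ Circuit M₅ Z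
  straddling _ (inj₁ (there (there ())))                               (inj₁ (_ ∷ _ ∷ [] , _ , refl))
  straddling _ (inj₂ (inj₁ (there (there (there ())))))               (inj₁ (_ ∷ _ ∷ [] , _ , refl))
  straddling _ (inj₂ (inj₂ (inj₁ (there (there (there (there ())))))))  (inj₁ (_ ∷ _ ∷ [] , _ , refl))
  straddling _ (inj₂ (inj₂ (inj₂ (there (there (there (there (there ())))))))) (inj₁ (_ ∷ _ ∷ [] , _ , refl))
  straddling (inj₁ ())          _ (inj₂ (_ , _ , refl))
  straddling (inj₂ (there ()))  _ (inj₂ (_ , _ , refl))

  ¬spikeMinor : SpikeMinorOf (Circuit M₅) → ⊥
  ¬spikeMinor σ = by-cases someLegContracted?
    where
    open Properties σ
    nonLoop₀ = nonLoop-in-circuit _ i0 i1 parallel₀₁ ∈! ∈! (λ ())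
    nonLoop₁ = nonLoop-in-circuit _ i1 i0 parallel₀₁ ∈! ∈! (λ ())
    nonLoop₂ = nonLoop-in-circuit _ i2 i5 parallel₂₅ ∈! ∈! (λ ())
    nonLoop₃ = nonLoop-in-circuit _ i3 i2 triangle₂₃₄ ∈! ∈! (λ ())
    nonLoop₄ = nonLoop-in-circuit _ i4 i2 triangle₂₃₄ ∈! ∈! (λ ())

    by-cases : Dec SomeLegContracted → ⊥
    by-cases (yes (e₀ , e₀∈X , p₀∈X)) = by-trace (trace-shape _ triangle₂₃₄)
      where
      open ContractedLeg e₀ e₀∈X p₀∈X
      partner₀≡f₁ : partner (f i0) ≡ f i1
      partner₀≡f₁ with trace-shape _ parallel₀₁
      ... | partnerClosed closed with Im-pair⁻ {i0} {i1} (closed i0 ∈! (nonLoop⇒partner∉X i0 nonLoop₀))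
      ...   | inj₁ eq = contradiction eq (partner-≢ (f i0))
      ...   | inj₂ eq = eq
      partner₀≡f₁ | meetsAllPairs meets with meets i2
      ...   | inj₁ f₂∈ = contradiction (f∈Im⇒∈ f₂∈) ∉!
      ...   | inj₂ p₂∈ with Im-pair⁻ {i0} {i1} (p₂∈ (nonLoop⇒partner∉X i2 nonLoop₂))
      ...     | inj₁ eq = contradiction (partner≡⇒parallel i2 i0 nonLoop₂ nonLoop₀ eq) (straddling (inj₁ ∈!) (inj₁ ∈!))
      ...     | inj₂ eq = contradiction (partner≡⇒parallel i2 i1 nonLoop₂ nonLoop₁ eq) (straddling (inj₂ ∈!) (inj₁ ∈!))
      by-trace : TraceShape (⁅ i2 ⁆ ∪ ⁅ i3 ⁆ ∪ ⁅ i4 ⁆) → ⊥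
      by-trace (partnerClosed closed) with Im-triple⁻ {i2} {i3} {i4} (closed i3 ∈! (nonLoop⇒partner∉X i3 nonLoop₃))
      ... | inj₁ eq        = partner≢-in-circuit _ triangle₂₃₄ i3 i2 i4 ∈! ∈! ∈! (λ ()) (λ ()) eq
      ... | inj₂ (inj₁ eq) = partner-≢ (f i3) eq
      ... | inj₂ (inj₂ eq) = partner≢-in-circuit _ triangle₂₃₄ i3 i4 i2 ∈! ∈! ∈! (λ ()) (λ ()) eq
      by-trace (meetsAllPairs meets) with meets i0
      ... | inj₁ f₀∈ = contradiction (f∈Im⇒∈ f₀∈) ∉!
      ... | inj₂ p₀∈ =
        contradiction (f∈Im⇒∈ (subst (_∈ Im f _) partner₀≡f₁ (p₀∈ λ p∈X → f∉X i1 (subst (_∈ X) partner₀≡f₁ p∈X)))) ∉!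
    by-cases (no none) = by-trace₂₅
      where
      open NoContractedLeg (¬some⇒noLegContracted none)
      two-partners : ∀ x y z (a b : Edge) → x ≢ y → x ≢ z → y ≢ z →
                     partner (f x) ≡ a ⊎ partner (f x) ≡ b → partner (f y) ≡ a ⊎ partner (f y) ≡ b →
                     partner (f z) ≡ a ⊎ partner (f z) ≡ b → ⊥
      two-partners x y z a b x≢y x≢z y≢z px py pz with pigeonhole₃ px py pz
      ... | inj₁ eq        = x≢y (f-injective (partner-injective eq))
      ... | inj₂ (inj₁ eq) = x≢z (f-injective (partner-injective eq))
      ... | inj₂ (inj₂ eq) = y≢z (f-injective (partner-injective eq))
      together₂₃₄ = partnersContracted⇒¬together _ triangle₂₃₄
      two-legs-contracted : PartnerContracted i0 → PartnerContracted i2 → ⊥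
      two-legs-contracted p₀ p₂ = straddling (inj₁ ∈!) (inj₁ ∈!) (partnersContracted⇒parallel i0 i2 (λ ()) nonLoop₀ nonLoop₂ p₀ p₂)

      contracted₂ : PartnerContracted i2 → ⊥
      contracted₂ p₂ = by-pair₀₁ (pair-trace i0 i1 parallel₀₁)
        where
        p₃∉X : ¬ PartnerContracted i3
        p₃∉X p₃ = together₂₃₄ i2 i3 i4 ∈! ∈! ∈! (λ ()) (λ ()) (λ ()) p₂ p₃
        p₄∉X : ¬ PartnerContracted i4
        p₄∉X p₄ = together₂₃₄ i2 i4 i3 ∈! ∈! ∈! (λ ()) (λ ()) (λ ()) p₂ p₄
        by-pair₀₁ : PartnerContracted i0 ⊎ PartnersAmong i0 i1 → ⊥
        by-pair₀₁ (inj₁ p₀) = two-legs-contracted p₀ p₂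
        by-pair₀₁ (inj₂ into₀₁) with into₀₁ i3 (λ ()) (λ ()) p₃∉X | into₀₁ i4 (λ ()) (λ ()) p₄∉X
        ... | inj₁ e₃ | inj₁ e₄ = contradiction (f-injective (partner-injective (trans e₃ (sym e₄)))) λ ()
        ... | inj₂ e₃ | inj₂ e₄ = contradiction (f-injective (partner-injective (trans e₃ (sym e₄)))) λ ()
        ... | inj₁ e₃ | inj₂ _  = straddling (inj₁ ∈!) (inj₁ ∈!) (triangle-of-legs i2 i3 i0 i4 p₂ e₃ p₄∉X (λ ()) (λ ()) (λ ()) (λ ()))
        ... | inj₂ e₃ | inj₁ _  = straddling (inj₂ ∈!) (inj₁ ∈!) (triangle-of-legs i2 i3 i1 i4 p₂ e₃ p₄∉X (λ ()) (λ ()) (λ ()) (λ ()))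

      meets-legs₂₅ : PartnersAmong i2 i5 → ⊥
      meets-legs₂₅ into₂₅ with partner (f i3) ∈? X | partner (f i4) ∈? X | partner (f i0) ∈? X | partner (f i1) ∈? X
      ... | yes p₃  | _       | _       | _       = two-partners i0 i1 i4 (f i2) (f i5) (λ ()) (λ ()) (λ ())
        (into₂₅ i0 (λ ()) (λ ()) λ p₀ →
          straddling (inj₁ ∈!) (inj₂ (inj₁ ∈!)) (partnersContracted⇒parallel i0 i3 (λ ()) nonLoop₀ nonLoop₃ p₀ p₃))
        (into₂₅ i1 (λ ()) (λ ()) λ p₁ →
          straddling (inj₂ ∈!) (inj₂ (inj₁ ∈!)) (partnersContracted⇒parallel i1 i3 (λ ()) nonLoop₁ nonLoop₃ p₁ p₃))
        (into₂₅ i4 (λ ()) (λ ()) λ p₄ → together₂₃₄ i3 i4 i2 ∈! ∈! ∈! (λ ()) (λ ()) (λ ()) p₃ p₄)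
      ... | no p₃∉X | yes p₄  | _       | _       = two-partners i0 i1 i3 (f i2) (f i5) (λ ()) (λ ()) (λ ())
        (into₂₅ i0 (λ ()) (λ ()) λ p₀ →
          straddling (inj₁ ∈!) (inj₂ (inj₂ (inj₁ ∈!))) (partnersContracted⇒parallel i0 i4 (λ ()) nonLoop₀ nonLoop₄ p₀ p₄))
        (into₂₅ i1 (λ ()) (λ ()) λ p₁ →
          straddling (inj₂ ∈!) (inj₂ (inj₂ (inj₁ ∈!))) (partnersContracted⇒parallel i1 i4 (λ ()) nonLoop₁ nonLoop₄ p₁ p₄))
        (into₂₅ i3 (λ ()) (λ ()) p₃∉X)
      ... | no p₃∉X | no p₄∉X | no p₀∉X | _       = two-partners i0 i3 i4 (f i2) (f i5) (λ ()) (λ ()) (λ ())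
        (into₂₅ i0 (λ ()) (λ ()) p₀∉X) (into₂₅ i3 (λ ()) (λ ()) p₃∉X) (into₂₅ i4 (λ ()) (λ ()) p₄∉X)
      ... | no p₃∉X | no p₄∉X | yes _   | no p₁∉X = two-partners i1 i3 i4 (f i2) (f i5) (λ ()) (λ ()) (λ ())
        (into₂₅ i1 (λ ()) (λ ()) p₁∉X) (into₂₅ i3 (λ ()) (λ ()) p₃∉X) (into₂₅ i4 (λ ()) (λ ()) p₄∉X)
      ... | no p₃∉X | no p₄∉X | yes p₀  | yes _   with into₂₅ i3 (λ ()) (λ ()) p₃∉X | into₂₅ i4 (λ ()) (λ ()) p₄∉X
      ...   | inj₁ e₃ | inj₁ e₄ = contradiction (f-injective (partner-injective (trans e₃ (sym e₄)))) λ ()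
      ...   | inj₂ e₃ | inj₂ e₄ = contradiction (f-injective (partner-injective (trans e₃ (sym e₄)))) λ ()
      ...   | inj₁ e₃ | inj₂ _  = straddling (inj₁ ∈!) (inj₁ ∈!)
                                    (triangle-of-legs i0 i2 i3 i4 p₀ (partner-sym e₃) p₄∉X (λ ()) (λ ()) (λ ()) (λ ()))
      ...   | inj₂ _  | inj₁ e₄ = straddling (inj₁ ∈!) (inj₁ ∈!)
                                    (triangle-of-legs i0 i2 i4 i3 p₀ (partner-sym e₄) p₃∉X (λ ()) (λ ()) (λ ()) (λ ()))

      by-trace₂₅ : ⊥
      by-trace₂₅ with pair-trace i2 i5 parallel₂₅
      ... | inj₁ p₂     = contracted₂ p₂
      ... | inj₂ into₂₅ = meets-legs₂₅ into₂₅

  U₁₂⊕M[H]∉𝒮 : ¬ InS M₅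
  U₁₂⊕M[H]∉𝒮 h = ¬spikeMinor (InS⇒SpikeMinorOf M₅ h)

proposition3p8 : ¬ InS (U 0 1 ⊕ U 1 1 ⊕ U 1 3) ×
    ¬ InS (U 0 1 ⊕ U 1 1 ⊕ U 2 3) ×
    ¬ InS (U 0 1 ⊕ U 2 4) ×
    ¬ InS (U 1 1 ⊕ U 2 4) ×
    ¬ InS (U 1 2 ⊕ CycleMatroid H)
proposition3p8 = Item-i.U₀₁⊕U₁₁⊕U₁₃∉𝒮 , Item-ii.U₀₁⊕U₁₁⊕U₂₃∉𝒮 , Item-iii.U₀₁⊕U₂₄∉𝒮 , Item-iv.U₁₁⊕U₂₄∉𝒮 , Item-v.U₁₂⊕M[H]∉𝒮
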